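{- Let $N\in\mathbb{Z}_{\geq2}$ be square-free. There exist square-free $\kappa_1\neq\kappa_2\in\mathbb{Z}_{\geq2}$ such that the polynomial $x^4-\kappa_it_Nx^2+\|\epsilon_N\|\kappa_i^2$ is reducible in $\mathbb{Z}[x]$ for $i=1,2$ if and only if $\|\epsilon_N\|=1$, in which case $\kappa_1,\kappa_2$ are the unique square-free integers such that $\kappa_1(t_N+2)$ and $\kappa_2(t_N-2)$ are perfect squares.
   Context: $\epsilon_N>1$ is the fundamental unit of the ring of integers of $\mathbb{Q}(\sqrt N)$ (every unit is $\pm\epsilon_N^m$, $m\in\mathbb{Z}$), $\|\cdot\|$ the field norm of $\mathbb{Q}(\sqrt N)/\mathbb{Q}$, and $\epsilon_N=\frac12(t_N+u_N\sqrt N)$ with $t_N,u_N\in\mathbb{Z}$, so that the minimal polynomial of $\epsilon_N$ is $x^2-t_Nx+\|\epsilon_N\|$. -}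

module Defs where

open import Data.Nat as ℕ using (ℕ; zero; suc)
open import Data.Integer as ℤ using (ℤ; +_; ∣_∣)
open import Data.Integer.Divisibility using (_∣_)
open import Data.Rational as ℚ using (ℚ; _/_; 0ℚ; 1ℚ)
open import Data.Product using (Σ; ∃; _×_; _,_; proj₁; proj₂)
open import Data.Sum using (_⊎_)
open import Relation.Binary.PropositionalEquality using (_≡_; _≢_)
open import Relation.Nullary using (¬_)

SquareFree : ℤ → Set
SquareFree n = ∀ (d : ℤ) → (d ℤ.* d) ∣ n → ∣ d ∣ ≡ 1

IsSquare : ℤ → Set
IsSquare z = ∃ λ (s : ℤ) → z ≡ s ℤ.* s

-- The quadratic field ℚ(√N): the pair (a , b) stands for a + b√N.

fromℤ : ℤ → ℚ
fromℤ z = z / 1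

K : Set
K = ℚ × ℚ

oneK : K
oneK = (1ℚ , 0ℚ)

negK : K → K
negK (a , b) = (ℚ.- a , ℚ.- b)

mulK : ℤ → K → K → K
mulK N (a , b) (c , d) = (a ℚ.* c ℚ.+ fromℤ N ℚ.* (b ℚ.* d) , a ℚ.* d ℚ.+ b ℚ.* c)

powK : ℤ → K → ℕ → K
powK N x zero    = oneK
powK N x (suc m) = mulK N x (powK N x m)

traceK : K → ℚ
traceK (a , b) = a ℚ.+ a

normK : ℤ → K → ℚ
normK N (a , b) = a ℚ.* a ℚ.- fromℤ N ℚ.* (b ℚ.* b)

IsIntegerℚ : ℚ → Set
IsIntegerℚ q = ∃ λ (z : ℤ) → q ≡ fromℤ z

-- x lies in the ring of integers O_N: its characteristic polynomial
-- X² − Tr(x) X + ‖x‖ over ℚ has integer coefficients.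
InO : ℤ → K → Set
InO N x = IsIntegerℚ (traceK x) × IsIntegerℚ (normK N x)

IsUnitO : ℤ → K → Set
IsUnitO N x = InO N x × ∃ λ (y : K) → InO N y × mulK N x y ≡ oneK

-- c < b·√N  (real comparison, written out for N > 0)
LtSqrt : ℤ → ℚ → ℚ → Set
LtSqrt N b c =
  (0ℚ ℚ.≤ b × (c ℚ.< 0ℚ ⊎ c ℚ.* c ℚ.< fromℤ N ℚ.* (b ℚ.* b)))
  ⊎ (b ℚ.< 0ℚ × c ℚ.< 0ℚ × fromℤ N ℚ.* (b ℚ.* b) ℚ.< c ℚ.* c)

-- a + b√N > 1  (as real numbers, √N the positive root)
GtOne : ℤ → K → Set
GtOne N (a , b) = LtSqrt N b (1ℚ ℚ.- a)

-- ε is the fundamental unit of O_N: ε > 1 is a unit and every unit is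
-- ±ε^m, m ∈ ℤ (negative m expressed as η·ε^|m| = ±1).
IsFundamentalUnit : ℤ → K → Set
IsFundamentalUnit N ε =
  IsUnitO N ε × GtOne N ε ×
  (∀ (η : K) → IsUnitO N η → ∃ λ (m : ℕ) →
      (η ≡ powK N ε m) ⊎ (η ≡ negK (powK N ε m))
    ⊎ (mulK N η (powK N ε m) ≡ oneK) ⊎ (mulK N η (powK N ε m) ≡ negK oneK))

-- Polynomials in ℤ[x] as coefficient sequences with finite support.

Seq : Set
Seq = ℕ → ℤ

IsPoly : Seq → Set
IsPoly f = ∃ λ (d : ℕ) → ∀ (i : ℕ) → d ℕ.< i → f i ≡ + 0

sumTo : (ℕ → ℤ) → ℕ → ℤ
sumTo h zero    = h zero
sumTo h (suc k) = sumTo h k ℤ.+ h (suc k)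

mulP : Seq → Seq → Seq
mulP f g n = sumTo (λ i → f i ℤ.* g (n ℕ.∸ i)) n

oneP : Seq
oneP zero    = + 1
oneP (suc _) = + 0

IsUnitP : Seq → Set
IsUnitP f = ∃ λ (g : Seq) → IsPoly g × (∀ n → mulP f g n ≡ oneP n)

ReducibleZ : Seq → Set
ReducibleZ f =
  IsPoly f × (∃ λ i → f i ≢ + 0) × ¬ IsUnitP f ×
  ∃ λ (g : Seq) → ∃ λ (h : Seq) →
    IsPoly g × IsPoly h × ¬ IsUnitP g × ¬ IsUnitP h × (∀ n → f n ≡ mulP g h n)

quartic : ℤ → ℤ → ℤ → Seq
quartic κ t n 0 = n ℤ.* (κ ℤ.* κ)
quartic κ t n 2 = ℤ.- (κ ℤ.* t)
quartic κ t n 4 = + 1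
quartic κ t n _ = + 0

GoodPair : ℤ → ℤ → ℤ → ℤ → Set
GoodPair t n κ₁ κ₂ =
  SquareFree κ₁ × SquareFree κ₂ × + 2 ℤ.≤ κ₁ × + 2 ℤ.≤ κ₂ × κ₁ ≢ κ₂ ×
  ReducibleZ (quartic κ₁ t n) × ReducibleZ (quartic κ₂ t n)

SquareClasses : ℤ → ℤ → ℤ → Set
SquareClasses t a b =
  IsSquare (a ℤ.* (t ℤ.+ + 2)) × IsSquare (b ℤ.* (t ℤ.- + 2)) ×
  (∀ κ → SquareFree κ → IsSquare (κ ℤ.* (t ℤ.+ + 2)) → κ ≡ a) ×
  (∀ κ → SquareFree κ → IsSquare (κ ℤ.* (t ℤ.- + 2)) → κ ≡ b)

module Submission where

-- A monic biquadratic x⁴ + bx² + c is reducible over ℤ only if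
-- b² − 4c is a square, or c = d² and 2d − b = p² (Biquadratic, resting
-- on coefficient arithmetic in Polynomial); for our quartic: κ²(t² − 4n)
-- is a square, or nκ² = d² with d = ±κ and κ(t ± 2) a square.  In
-- QuadraticField the norm of a unit is ±1, ε > 1 bounds t below, and for
-- n = 1 neither t + 2 nor t − 2 is a square, as otherwise ε would have a
-- unit square root.  Since t² ± 4 are then no squares, n = −1 admits no
-- reducible quartic, while for n = 1 reducibility means that κ is the
-- square class of t + 2 or of t − 2 (SquareClass, IntegerSquares).

module Polynomial where

  open import Defs
  open import Data.Nat as ℕ using (ℕ; zero; suc; _∸_; _<_; _≤_; z≤n; s≤s)
  import Data.Nat.Properties as ℕP
  open import Data.Integer as ℤ using (ℤ; +_)
  import Data.Integer.Properties as ℤP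
  open import Data.Product using (∃; _×_; _,_)
  open import Data.Sum using (_⊎_; inj₁; inj₂)
  open import Data.Empty using (⊥-elim)
  open import Relation.Nullary using (¬_; yes; no)
  open import Relation.Binary.PropositionalEquality
  open import Relation.Binary.Definitions using (tri<; tri≈; tri>)
  open ≡-Reasoning

  sumTo-cong : ∀ f g n → (∀ i → i ≤ n → f i ≡ g i) → sumTo f n ≡ sumTo g n
  sumTo-cong f g zero    f≗g = f≗g 0 z≤n
  sumTo-cong f g (suc n) f≗g =
    cong₂ ℤ._+_ (sumTo-cong f g n (λ i i≤n → f≗g i (ℕP.m≤n⇒m≤1+n i≤n))) (f≗g (suc n) ℕP.≤-refl)

  sumTo-zero : ∀ f n → (∀ i → i ≤ n → f i ≡ + 0) → sumTo f n ≡ + 0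
  sumTo-zero f zero    f≡0 = f≡0 0 z≤n
  sumTo-zero f (suc n) f≡0 =
    cong₂ ℤ._+_ (sumTo-zero f n (λ i i≤n → f≡0 i (ℕP.m≤n⇒m≤1+n i≤n))) (f≡0 (suc n) ℕP.≤-refl)

  sumTo-single : ∀ f n k → k ≤ n → (∀ i → i ≤ n → i ≢ k → f i ≡ + 0) → sumTo f n ≡ f k
  sumTo-single f zero    .zero z≤n  _   = refl
  sumTo-single f (suc n) k     k≤1+n off with ℕP.m≤n⇒m<n∨m≡n k≤1+n
  ... | inj₁ (s≤s k≤n) = begin
    sumTo f n ℤ.+ f (suc n)
      ≡⟨ cong₂ ℤ._+_ (sumTo-single f n k k≤n (λ i i≤n → off i (ℕP.m≤n⇒m≤1+n i≤n)))
                     (off (suc n) ℕP.≤-refl (λ 1+n≡k → ℕP.<⇒≢ (s≤s k≤n) (sym 1+n≡k))) ⟩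
    f k ℤ.+ + 0
      ≡⟨ ℤP.+-identityʳ (f k) ⟩
    f k ∎
  ... | inj₂ refl = begin
    sumTo f n ℤ.+ f (suc n)
      ≡⟨ cong (ℤ._+ f (suc n)) (sumTo-zero f n (λ i i≤n → off i (ℕP.m≤n⇒m≤1+n i≤n) (ℕP.<⇒≢ (s≤s i≤n)))) ⟩
    + 0 ℤ.+ f (suc n)
      ≡⟨ ℤP.+-identityˡ (f (suc n)) ⟩
    f (suc n) ∎

  sumTo-head : ∀ f n → sumTo f (suc n) ≡ f 0 ℤ.+ sumTo (λ i → f (suc i)) n
  sumTo-head f zero    = refl
  sumTo-head f (suc n) = begin
    sumTo f (suc n) ℤ.+ f (suc (suc n))
      ≡⟨ cong (ℤ._+ f (suc (suc n))) (sumTo-head f n) ⟩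
    f 0 ℤ.+ sumTo (λ i → f (suc i)) n ℤ.+ f (suc (suc n))
      ≡⟨ ℤP.+-assoc (f 0) _ _ ⟩
    f 0 ℤ.+ sumTo (λ i → f (suc i)) (suc n) ∎

  sumTo-reverse : ∀ f n → sumTo f n ≡ sumTo (λ i → f (n ∸ i)) n
  sumTo-reverse f zero    = refl
  sumTo-reverse f (suc n) = begin
    sumTo f n ℤ.+ f (suc n)
      ≡⟨ cong (ℤ._+ f (suc n)) (sumTo-reverse f n) ⟩
    sumTo (λ i → f (n ∸ i)) n ℤ.+ f (suc n)
      ≡⟨ ℤP.+-comm _ (f (suc n)) ⟩
    f (suc n) ℤ.+ sumTo (λ i → f (n ∸ i)) n
      ≡⟨ sym (sumTo-head (λ i → f (suc n ∸ i)) n) ⟩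
    sumTo (λ i → f (suc n ∸ i)) (suc n) ∎

  mulP-comm : ∀ g h n → mulP g h n ≡ mulP h g n
  mulP-comm g h n = begin
    sumTo (λ i → g i ℤ.* h (n ∸ i)) n
      ≡⟨ sumTo-reverse _ n ⟩
    sumTo (λ i → g (n ∸ i) ℤ.* h (n ∸ (n ∸ i))) n
      ≡⟨ sumTo-cong _ _ n swap ⟩
    sumTo (λ i → h i ℤ.* g (n ∸ i)) n ∎
    where
    swap : ∀ i → i ≤ n → g (n ∸ i) ℤ.* h (n ∸ (n ∸ i)) ≡ h i ℤ.* g (n ∸ i)
    swap i i≤n = trans (cong (λ j → g (n ∸ i) ℤ.* h j) (ℕP.m∸[m∸n]≡n i≤n)) (ℤP.*-comm (g (n ∸ i)) (h i))

  DegreeAtMost : Seq → ℕ → Set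
  DegreeAtMost g d = ∀ i → d < i → g i ≡ + 0

  HasDegree : Seq → ℕ → Set
  HasDegree g d = g d ≢ + 0 × DegreeAtMost g d

  1≢0 : + 1 ≢ + 0
  1≢0 ()

  *-nonzero : ∀ {i j} → i ≢ + 0 → j ≢ + 0 → i ℤ.* j ≢ + 0
  *-nonzero {i} i≢0 j≢0 ij≡0 with ℤP.i*j≡0⇒i≡0∨j≡0 i ij≡0
  ... | inj₁ i≡0 = i≢0 i≡0
  ... | inj₂ j≡0 = j≢0 j≡0

  mulP-top : ∀ g h dg dh → DegreeAtMost g dg → DegreeAtMost h dh →
             mulP g h (dg ℕ.+ dh) ≡ g dg ℤ.* h dh
  mulP-top g h dg dh g≤ h≤ =
    trans (sumTo-single _ (dg ℕ.+ dh) dg (ℕP.m≤m+n dg dh) off)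
          (cong (λ j → g dg ℤ.* h j) (ℕP.m+n∸m≡n dg dh))
    where
    off : ∀ i → i ≤ dg ℕ.+ dh → i ≢ dg → g i ℤ.* h (dg ℕ.+ dh ∸ i) ≡ + 0
    off i i≤ i≢dg with ℕP.<-cmp i dg
    ... | tri< i<dg _ _ = trans (cong (g i ℤ.*_) (h≤ _ dh<)) (ℤP.*-zeroʳ (g i))
      where
      dh< : dh < dg ℕ.+ dh ∸ i
      dh< = ℕP.+-cancelʳ-< i dh (dg ℕ.+ dh ∸ i)
              (subst (dh ℕ.+ i <_) (sym (ℕP.m∸n+n≡m i≤))
                (subst (_< dg ℕ.+ dh) (ℕP.+-comm i dh) (ℕP.+-monoˡ-< dh i<dg)))
    ... | tri≈ _ i≡dg _ = ⊥-elim (i≢dg i≡dg)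
    ... | tri> _ _ dg<i = trans (cong (ℤ._* h (dg ℕ.+ dh ∸ i)) (g≤ i dg<i)) (ℤP.*-zeroˡ (h (dg ℕ.+ dh ∸ i)))

  mulP-degree : ∀ g h dg dh → DegreeAtMost g dg → DegreeAtMost h dh →
                DegreeAtMost (mulP g h) (dg ℕ.+ dh)
  mulP-degree g h dg dh g≤ h≤ n d<n = sumTo-zero _ n term
    where
    term : ∀ i → i ≤ n → g i ℤ.* h (n ∸ i) ≡ + 0
    term i i≤n with ℕP.≤-<-connex i dg
    ... | inj₁ i≤dg = trans (cong (g i ℤ.*_) (h≤ _ (ℕP.m+n≤o⇒m≤o∸n (suc dh) lt))) (ℤP.*-zeroʳ (g i))
      where
      lt : suc dh ℕ.+ i ≤ n
      lt = ℕP.≤-trans (s≤s (subst (_≤ dg ℕ.+ dh) (ℕP.+-comm i dh) (ℕP.+-monoˡ-≤ dh i≤dg))) d<n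
    ... | inj₂ dg<i = trans (cong (ℤ._* h (n ∸ i)) (g≤ i dg<i)) (ℤP.*-zeroˡ (h (n ∸ i)))

  mulP-zeroˡ : ∀ g h → (∀ i → g i ≡ + 0) → ∀ n → mulP g h n ≡ + 0
  mulP-zeroˡ g h g≡0 n =
    sumTo-zero _ n (λ i _ → trans (cong (ℤ._* h (n ∸ i)) (g≡0 i)) (ℤP.*-zeroˡ (h (n ∸ i))))

  zeroOrDegree : ∀ g D → DegreeAtMost g D → (∀ i → g i ≡ + 0) ⊎ ∃ (HasDegree g)
  zeroOrDegree g D g≤D with g D ℤ.≟ + 0
  ... | no gD≢0 = inj₂ (D , gD≢0 , g≤D)
  zeroOrDegree g zero    g≤0 | yes g0≡0 = inj₁ λ where
    zero    → g0≡0
    (suc i) → g≤0 (suc i) (s≤s z≤n)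
  zeroOrDegree g (suc D) g≤1+D | yes gD≡0 = zeroOrDegree g D g≤D
    where
    g≤D : DegreeAtMost g D
    g≤D i D<i with ℕP.m≤n⇒m<n∨m≡n D<i
    ... | inj₁ 1+D<i = g≤1+D i 1+D<i
    ... | inj₂ refl  = gD≡0

  positiveDegree⇒nonUnit : ∀ g d → HasDegree g (suc d) → ¬ IsUnitP g
  positiveDegree⇒nonUnit g d (gd≢0 , g≤d) (g′ , (D , g′≤D) , gg′≡1)
    with zeroOrDegree g′ D g′≤D
  ... | inj₁ g′≡0 = 1≢0 (trans (sym (gg′≡1 0)) (trans (mulP-comm g g′ 0) (mulP-zeroˡ g′ g g′≡0 0)))
  ... | inj₂ (d′ , g′d′≢0 , g′≤d′) =
    *-nonzero gd≢0 g′d′≢0 (trans (sym (mulP-top g g′ (suc d) d′ g≤d g′≤d′)) (gg′≡1 (suc d ℕ.+ d′)))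

  constant : ℤ → Seq
  constant c zero    = c
  constant c (suc _) = + 0

  constant⇒unit : ∀ g c → DegreeAtMost g 0 → g 0 ℤ.* c ≡ + 1 → IsUnitP g
  constant⇒unit g c g≤0 gc≡1 = constant c , (0 , λ { (suc i) _ → refl }) , inverse
    where
    inverse : ∀ n → mulP g (constant c) n ≡ oneP n
    inverse zero    = gc≡1
    inverse (suc n) = sumTo-zero _ (suc n) term
      where
      term : ∀ i → i ≤ suc n → g i ℤ.* constant c (suc n ∸ i) ≡ + 0
      term zero    _ = ℤP.*-zeroʳ (g 0)
      term (suc i) _ = trans (cong (ℤ._* constant c (n ∸ i)) (g≤0 (suc i) (s≤s z≤n))) (ℤP.*-zeroˡ (constant c (n ∸ i)))

module Biquadratic where

  open import Defs
  open Polynomial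
  open import Data.Nat as ℕ using (suc; _<_; z≤n; s≤s)
  import Data.Nat.Properties as ℕP
  open import Data.Integer as ℤ using (ℤ; +_; _+_; _-_; _*_; -_)
  import Data.Integer.Properties as ℤP
  open import Data.Integer.Tactic.RingSolver using (solve)
  open import Data.List using (_∷_; [])
  open import Data.Product using (∃; _×_; _,_; proj₂)
  open import Data.Sum using (_⊎_; inj₁; inj₂)
  open import Data.Empty using (⊥-elim)
  open import Relation.Nullary using (¬_)
  open import Relation.Binary.PropositionalEquality
  open import Relation.Binary.Definitions using (tri<; tri≈; tri>)
  open ≡-Reasoning

  -- The two ways a monic biquadratic x⁴ + b x² + c can factor over ℤ:
  -- the quadratic y² + b y + c (y = x²) has a square discriminant, or
  -- x⁴ + b x² + c = (x² + d)² − (p x)² with c = d² and b = 2d − p².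
  Splits : ℤ → ℤ → Set
  Splits b c = (∃ λ s → b * b - + 4 * c ≡ s * s)
             ⊎ (∃ λ d → ∃ λ p → c ≡ d * d × + 2 * d - b ≡ p * p)

  MonicBiquadratic : Seq → Set
  MonicBiquadratic f = DegreeAtMost f 4 × f 1 ≡ + 0 × f 3 ≡ + 0 × f 4 ≡ + 1

  -- The coefficient equations of x⁴ + b x² + c = (Σ gᵢ xⁱ)(Σ hᵢ xⁱ) for
  -- factors of degree ≤ 4, written exactly as 'mulP' computes them.
  record FactorEqs (b c g0 g1 g2 g3 g4 h0 h1 h2 h3 h4 : ℤ) : Set where
    constructor coefficients
    field
      x⁰ : c ≡ g0 * h0
      x¹ : + 0 ≡ g0 * h1 + g1 * h0
      x² : b ≡ g0 * h2 + g1 * h1 + g2 * h0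
      x³ : + 0 ≡ g0 * h3 + g1 * h2 + g2 * h1 + g3 * h0
      x⁴ : + 1 ≡ g0 * h4 + g1 * h3 + g2 * h2 + g3 * h1 + g4 * h0

  factorEqs : ∀ f g h → MonicBiquadratic f → (∀ n → f n ≡ mulP g h n) →
    FactorEqs (f 2) (f 0) (g 0) (g 1) (g 2) (g 3) (g 4) (h 0) (h 1) (h 2) (h 3) (h 4)
  factorEqs f g h (_ , f1≡0 , f3≡0 , f4≡1) f≡gh = coefficients
    (f≡gh 0) (trans (sym f1≡0) (f≡gh 1)) (f≡gh 2) (trans (sym f3≡0) (f≡gh 3)) (trans (sym f4≡1) (f≡gh 4))

  vanishing : ∀ {b c g0 g1 g2 g3 g4 h0 h1 h2 h3 h4} → g3 ≡ + 0 → g4 ≡ + 0 → h4 ≡ + 0 →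
    FactorEqs b c g0 g1 g2 g3 g4 h0 h1 h2 h3 h4 → FactorEqs b c g0 g1 g2 (+ 0) (+ 0) h0 h1 h2 h3 (+ 0)
  vanishing refl refl refl eqs = eqs

  -- Comparing x³ gives H₁ = −G₁, and then x¹ gives G₁(H₀ − G₀) = 0: if
  -- G₁ = 0 the discriminant is (G₀ − H₀)², otherwise H₀ = G₀ and the
  -- factorisation is (x² + G₀)² − (G₁x)².
  symmetricFactors : ∀ G0 G1 H0 → G1 * (H0 - G0) ≡ + 0 → Splits (G0 + H0 + G1 * - G1) (G0 * H0)
  symmetricFactors G0 G1 H0 G1[H0-G0]≡0 with ℤP.i*j≡0⇒i≡0∨j≡0 G1 G1[H0-G0]≡0
  ... | inj₁ refl = inj₁ (G0 - H0 , (begin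
    (G0 + H0 + + 0 * - + 0) * (G0 + H0 + + 0 * - + 0) - + 4 * (G0 * H0) ≡⟨ solve (G0 ∷ H0 ∷ []) ⟩
    (G0 - H0) * (G0 - H0)                                                ∎))
  ... | inj₂ H0-G0≡0 rewrite ℤP.i-j≡0⇒i≡j H0 G0 H0-G0≡0 =
    inj₂ (G0 , G1 , refl , (begin
      + 2 * G0 - (G0 + G0 + G1 * - G1) ≡⟨ solve (G0 ∷ G1 ∷ []) ⟩
      G1 * G1                          ∎))

  monicQuadraticFactors : ∀ b c G0 G1 H0 H1 → G1 + H1 ≡ + 0 → G0 + H0 + G1 * H1 ≡ b →
    G0 * H1 + G1 * H0 ≡ + 0 → G0 * H0 ≡ c → Splits b c
  monicQuadraticFactors .(G0 + H0 + G1 * H1) .(G0 * H0) G0 G1 H0 H1 x³ refl x¹ refl =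
    subst (λ v → Splits (G0 + H0 + G1 * v) (G0 * H0)) (sym H1≡-G1)
      (symmetricFactors G0 G1 H0 G1[H0-G0]≡0)
    where
    H1≡-G1 : H1 ≡ - G1
    H1≡-G1 = ℤP.i-j≡0⇒i≡j H1 (- G1) (begin
      H1 - - G1  ≡⟨ solve (H1 ∷ G1 ∷ []) ⟩
      G1 + H1    ≡⟨ x³ ⟩
      + 0        ∎)
    G1[H0-G0]≡0 : G1 * (H0 - G0) ≡ + 0
    G1[H0-G0]≡0 = begin
      G1 * (H0 - G0)                          ≡⟨ solve (G0 ∷ G1 ∷ H0 ∷ H1 ∷ []) ⟩
      G0 * H1 + G1 * H0 - G0 * (G1 + H1)      ≡⟨ cong₂ (λ u v → u - G0 * v) x¹ x³ ⟩
      + 0 - G0 * + 0                          ≡⟨ solve (G0 ∷ []) ⟩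
      + 0                                     ∎

  -- An integer root r of x⁴ + b x² + c makes b² − 4c = (2r² + b)².
  root⇒splits : ∀ b c r → r * r * (r * r) + b * (r * r) + c ≡ + 0 → Splits b c
  root⇒splits b c r root = inj₁ (+ 2 * (r * r) + b , (begin
    b * b - + 4 * c
      ≡⟨ solve (b ∷ c ∷ r ∷ []) ⟩
    (+ 2 * (r * r) + b) * (+ 2 * (r * r) + b) - + 4 * (r * r * (r * r) + b * (r * r) + c)
      ≡⟨ cong (λ v → (+ 2 * (r * r) + b) * (+ 2 * (r * r) + b) - + 4 * v) root ⟩
    (+ 2 * (r * r) + b) * (+ 2 * (r * r) + b) - + 4 * + 0
      ≡⟨ solve (b ∷ r ∷ []) ⟩
    (+ 2 * (r * r) + b) * (+ 2 * (r * r) + b) ∎))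

  -- Two quadratic factors: since g₂h₂ = 1, the rescaled factors h₂·g and
  -- g₂·h are monic with the same product.
  quadraticFactors : ∀ {b c g0 g1 g2 h0 h1 h2 h3} → h3 ≡ + 0 →
    FactorEqs b c g0 g1 g2 (+ 0) (+ 0) h0 h1 h2 h3 (+ 0) → Splits b c
  quadraticFactors {b} {c} {g0} {g1} {g2} {h0} {h1} {h2} refl (coefficients x⁰ x¹ x² x³ x⁴) =
    monicQuadraticFactors b c (g0 * h2) (g1 * h2) (g2 * h0) (g2 * h1) x³′ x²′ x¹′ x⁰′
    where
    u : g2 * h2 ≡ + 1
    u = begin
      g2 * h2                                                       ≡⟨ solve (g0 ∷ g1 ∷ g2 ∷ h0 ∷ h1 ∷ h2 ∷ []) ⟩
      g0 * + 0 + g1 * + 0 + g2 * h2 + + 0 * h1 + + 0 * h0           ≡⟨ sym x⁴ ⟩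
      + 1                                                           ∎
    x³′ : g1 * h2 + g2 * h1 ≡ + 0
    x³′ = begin
      g1 * h2 + g2 * h1                          ≡⟨ solve (g0 ∷ g1 ∷ g2 ∷ h0 ∷ h1 ∷ h2 ∷ []) ⟩
      g0 * + 0 + g1 * h2 + g2 * h1 + + 0 * h0    ≡⟨ sym x³ ⟩
      + 0                                        ∎
    x²′ : g0 * h2 + g2 * h0 + g1 * h2 * (g2 * h1) ≡ b
    x²′ = begin
      g0 * h2 + g2 * h0 + g1 * h2 * (g2 * h1) ≡⟨ solve (g0 ∷ g1 ∷ g2 ∷ h0 ∷ h1 ∷ h2 ∷ []) ⟩
      g0 * h2 + g1 * h1 * (g2 * h2) + g2 * h0 ≡⟨ cong (λ v → g0 * h2 + g1 * h1 * v + g2 * h0) u ⟩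
      g0 * h2 + g1 * h1 * + 1 + g2 * h0       ≡⟨ solve (g0 ∷ g1 ∷ g2 ∷ h0 ∷ h1 ∷ h2 ∷ []) ⟩
      g0 * h2 + g1 * h1 + g2 * h0             ≡⟨ sym x² ⟩
      b                                       ∎
    x¹′ : g0 * h2 * (g2 * h1) + g1 * h2 * (g2 * h0) ≡ + 0
    x¹′ = begin
      g0 * h2 * (g2 * h1) + g1 * h2 * (g2 * h0) ≡⟨ solve (g0 ∷ g1 ∷ g2 ∷ h0 ∷ h1 ∷ h2 ∷ []) ⟩
      (g0 * h1 + g1 * h0) * (g2 * h2)           ≡⟨ cong₂ _*_ (sym x¹) u ⟩
      + 0 * + 1                                 ≡⟨⟩
      + 0                                       ∎
    x⁰′ : g0 * h2 * (g2 * h0) ≡ c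
    x⁰′ = begin
      g0 * h2 * (g2 * h0) ≡⟨ solve (g0 ∷ g2 ∷ h0 ∷ h2 ∷ []) ⟩
      g0 * h0 * (g2 * h2) ≡⟨ cong₂ _*_ (sym x⁰) u ⟩
      c * + 1             ≡⟨ ℤP.*-identityʳ c ⟩
      c                   ∎

  -- If g₀ + g₁r = 0 then r is a root of x⁴ + b x² + c = (g₀ + g₁x)·H(x),
  -- H = h₀ + h₁x + h₂x² + h₃x³: the value at r differs from (g₀ + g₁r)·H(r)
  -- by multiples of the coefficient equations of x⁴, x³ and x¹.
  remainderVanishes : ∀ r P Q A B C → P ≡ + 0 → + 1 ≡ A → + 0 ≡ B → + 0 ≡ C →
    P * Q + r * r * (r * r) * (+ 1 - A) - r * (r * r) * B - r * C ≡ + 0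
  remainderVanishes r .(+ 0) Q .(+ 1) .(+ 0) .(+ 0) refl refl refl refl = begin
    + 0 * Q + r * r * (r * r) * (+ 1 - + 1) - r * (r * r) * + 0 - r * + 0 ≡⟨ solve (r ∷ Q ∷ []) ⟩
    + 0                                                                   ∎

  linearFactorRoot : ∀ {b c g0 g1 h0 h1 h2 h3} r → g0 + g1 * r ≡ + 0 →
    FactorEqs b c g0 g1 (+ 0) (+ 0) (+ 0) h0 h1 h2 h3 (+ 0) →
    r * r * (r * r) + b * (r * r) + c ≡ + 0
  linearFactorRoot {g0 = g0} {g1} {h0} {h1} {h2} {h3} r root (coefficients refl x¹ refl x³ x⁴) = begin
    r * r * (r * r) + (g0 * h2 + g1 * h1 + + 0 * h0) * (r * r) + g0 * h0
      ≡⟨ solve (g0 ∷ g1 ∷ h0 ∷ h1 ∷ h2 ∷ h3 ∷ r ∷ []) ⟩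
    (g0 + g1 * r) * (h0 + h1 * r + h2 * (r * r) + h3 * (r * (r * r)))
      + r * r * (r * r) * (+ 1 - (g0 * + 0 + g1 * h3 + + 0 * h2 + + 0 * h1 + + 0 * h0))
      - r * (r * r) * (g0 * h3 + g1 * h2 + + 0 * h1 + + 0 * h0)
      - r * (g0 * h1 + g1 * h0)
      ≡⟨ remainderVanishes r _ _ _ _ _ root x⁴ x³ x¹ ⟩
    + 0 ∎

  -- A linear factor g₀ + g₁x: since g₁h₃ = 1, r = −g₀h₃ is its root.
  linearFactor : ∀ {b c g0 g1 g2 h0 h1 h2 h3} → g2 ≡ + 0 →
    FactorEqs b c g0 g1 g2 (+ 0) (+ 0) h0 h1 h2 h3 (+ 0) → Splits b c
  linearFactor {b} {c} {g0} {g1} {_} {h0} {h1} {h2} {h3} refl eqs@(coefficients _ _ _ _ x⁴) =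
    root⇒splits b c (- (g0 * h3)) (linearFactorRoot (- (g0 * h3)) root eqs)
    where
    root : g0 + g1 * - (g0 * h3) ≡ + 0
    root = begin
      g0 + g1 * - (g0 * h3)
        ≡⟨ solve (g0 ∷ g1 ∷ h0 ∷ h1 ∷ h2 ∷ h3 ∷ []) ⟩
      g0 * (+ 1 - (g0 * + 0 + g1 * h3 + + 0 * h2 + + 0 * h1 + + 0 * h0))
        ≡⟨ cong (λ v → g0 * (+ 1 - v)) (sym x⁴) ⟩
      g0 * (+ 1 - + 1)
        ≡⟨ ℤP.*-zeroʳ g0 ⟩
      + 0 ∎

  -- A factorisation f = g·h of a monic biquadratic into non-units with
  -- deg g ≤ 2 makes f split: deg g = 0 would make g a unit, and the
  -- cases deg g = 1, 2 are 'linearFactor' and 'quadraticFactors'.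
  smallFactor : ∀ f g h → MonicBiquadratic f → (∀ n → f n ≡ mulP g h n) → ¬ IsUnitP g →
    ∀ dg dh → HasDegree g dg → HasDegree h dh → dg ℕ.+ dh ≡ 4 → dg ℕ.≤ 2 → Splits (f 2) (f 0)
  smallFactor f g h mf@(_ , _ , _ , f4≡1) f≡gh g-nonunit 0 .4 (_ , g≤0) (_ , h≤4) refl _ =
    ⊥-elim (g-nonunit (constant⇒unit g (h 4) g≤0 (sym (trans (sym f4≡1) (trans (f≡gh 4) (mulP-top g h 0 4 g≤0 h≤4))))))
  smallFactor f g h mf f≡gh _ 1 .3 (_ , g≤1) (_ , h≤3) refl _ =
    linearFactor (g≤1 2 (s≤s (s≤s z≤n)))
      (vanishing (g≤1 3 (s≤s (s≤s z≤n))) (g≤1 4 (s≤s (s≤s z≤n))) (h≤3 4 ℕP.≤-refl) (factorEqs f g h mf f≡gh))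
  smallFactor f g h mf f≡gh _ 2 .2 (_ , g≤2) (_ , h≤2) refl _ =
    quadraticFactors (h≤2 3 ℕP.≤-refl)
      (vanishing (g≤2 3 ℕP.≤-refl) (g≤2 4 (s≤s (s≤s (s≤s z≤n)))) (h≤2 4 (s≤s (s≤s (s≤s z≤n))))
        (factorEqs f g h mf f≡gh))
  smallFactor f g h mf f≡gh _ (suc (suc (suc _))) _ _ _ _ (s≤s (s≤s ()))

  factorDegrees : ∀ f g h dg dh → MonicBiquadratic f → (∀ n → f n ≡ mulP g h n) →
    HasDegree g dg → HasDegree h dh → dg ℕ.+ dh ≡ 4
  factorDegrees f g h dg dh (f≤4 , _ , _ , f4≡1) f≡gh (gdg≢0 , g≤dg) (hdh≢0 , h≤dh)
    with ℕP.<-cmp (dg ℕ.+ dh) 4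
  ... | tri< below _ _ = ⊥-elim (1≢0 (trans (sym f4≡1) (trans (f≡gh 4) (mulP-degree g h dg dh g≤dg h≤dh 4 below))))
  ... | tri≈ _ exact _ = exact
  ... | tri> _ _ above = ⊥-elim (*-nonzero gdg≢0 hdh≢0
          (trans (sym (mulP-top g h dg dh g≤dg h≤dh)) (trans (sym (f≡gh (dg ℕ.+ dh))) (f≤4 _ above))))

  reducible⇒splits : ∀ f → MonicBiquadratic f → ReducibleZ f → Splits (f 2) (f 0)
  reducible⇒splits f mf@(_ , _ , _ , f4≡1)
    (_ , _ , _ , g , h , (Dg , g≤Dg) , (Dh , h≤Dh) , g-nonunit , h-nonunit , f≡gh)
    with zeroOrDegree g Dg g≤Dg | zeroOrDegree h Dh h≤Dh
  ... | inj₁ g≡0 | _ = ⊥-elim (1≢0 (trans (sym f4≡1) (trans (f≡gh 4) (mulP-zeroˡ g h g≡0 4))))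
  ... | inj₂ _ | inj₁ h≡0 =
    ⊥-elim (1≢0 (trans (sym f4≡1) (trans (f≡gh 4) (trans (mulP-comm g h 4) (mulP-zeroˡ h g h≡0 4)))))
  ... | inj₂ (dg , degG) | inj₂ (dh , degH) with ℕP.≤-total dg 2
  ...   | inj₁ dg≤2 = smallFactor f g h mf f≡gh g-nonunit dg dh degG degH dg+dh≡4 dg≤2
    where
    dg+dh≡4 : dg ℕ.+ dh ≡ 4
    dg+dh≡4 = factorDegrees f g h dg dh mf f≡gh degG degH
  ...   | inj₂ 2≤dg = smallFactor f h g mf h≡hg h-nonunit dh dg degH degG dh+dg≡4 dh≤2
    where
    h≡hg : ∀ n → f n ≡ mulP h g n
    h≡hg n = trans (f≡gh n) (mulP-comm g h n)
    dh+dg≡4 : dh ℕ.+ dg ≡ 4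
    dh+dg≡4 = factorDegrees f h g dh dg mf h≡hg degH degG
    dh≤2 : dh ℕ.≤ 2
    dh≤2 = ℕP.+-cancelʳ-≤ dg dh 2 (ℕP.≤-trans (ℕP.≤-reflexive dh+dg≡4) (ℕP.+-monoʳ-≤ 2 2≤dg))

  -- Conversely, x⁴ + (2d − p²)x² + d² = (x² + px + d)(x² − px + d) is
  -- reducible.
  quadratic : ℤ → ℤ → Seq
  quadratic d p 0 = d
  quadratic d p 1 = p
  quadratic d p 2 = + 1
  quadratic d p _ = + 0

  quadratic-degree : ∀ d p → HasDegree (quadratic d p) 2
  quadratic-degree d p = (λ ()) , above
    where
    above : DegreeAtMost (quadratic d p) 2
    above (suc (suc (suc i))) _ = refl
    above 0 ()
    above 1 (s≤s ())
    above 2 (s≤s (s≤s ()))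

  differenceOfSquares⇒reducible : ∀ f d p → MonicBiquadratic f → f 0 ≡ d * d → f 2 ≡ + 2 * d - p * p →
    ReducibleZ f
  differenceOfSquares⇒reducible f d p mf@(f≤4 , f1≡0 , f3≡0 , f4≡1) f0≡d² f2≡2d-p² =
    (4 , f≤4) , (4 , f4≢0) , positiveDegree⇒nonUnit f 3 (f4≢0 , f≤4) ,
    quadratic d p , quadratic d (- p) , (2 , proj₂ (quadratic-degree d p)) , (2 , proj₂ (quadratic-degree d (- p))) ,
    positiveDegree⇒nonUnit _ 1 (quadratic-degree d p) , positiveDegree⇒nonUnit _ 1 (quadratic-degree d (- p)) ,
    product
    where
    f4≢0 : f 4 ≢ + 0
    f4≢0 f4≡0 = 1≢0 (trans (sym f4≡1) f4≡0)
    product : ∀ n → f n ≡ mulP (quadratic d p) (quadratic d (- p)) n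
    product 0 = f0≡d²
    product 1 = begin
      f 1                ≡⟨ f1≡0 ⟩
      + 0                ≡⟨ solve (d ∷ p ∷ []) ⟩
      d * - p + p * d    ∎
    product 2 = begin
      f 2                                  ≡⟨ f2≡2d-p² ⟩
      + 2 * d - p * p                      ≡⟨ solve (d ∷ p ∷ []) ⟩
      d * + 1 + p * - p + + 1 * d          ∎
    product 3 = begin
      f 3                                  ≡⟨ f3≡0 ⟩
      + 0                                  ≡⟨ solve (d ∷ p ∷ []) ⟩
      d * + 0 + p * + 1 + + 1 * - p + + 0 * d ∎
    product 4 = begin
      f 4                                               ≡⟨ f4≡1 ⟩
      + 1                                               ≡⟨ solve (d ∷ p ∷ []) ⟩
      d * + 0 + p * + 0 + + 1 * + 1 + + 0 * - p + + 0 * d ∎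
    product (suc (suc (suc (suc (suc n))))) = trans (f≤4 _ above4) (sym
      (mulP-degree _ _ 2 2 (proj₂ (quadratic-degree d p)) (proj₂ (quadratic-degree d (- p))) _ above4))
      where
      above4 : 4 < suc (suc (suc (suc (suc n))))
      above4 = s≤s (s≤s (s≤s (s≤s (s≤s z≤n))))

module SquareClass where

  open import Data.Nat as ℕ using (ℕ; zero; suc; _*_; _≤_; _<_; NonZero; z≤n; s≤s)
  import Data.Nat.Properties as ℕP
  open import Data.Nat.Divisibility
  open import Data.Nat.Coprimality using (Coprime; coprime-divisor)
  open import Data.Nat.GCD using (gcd; gcd[m,n]∣m; gcd[m,n]∣n; gcd-greatest; gcd[m,n]≢0)
  open import Data.Nat.Induction using (<-rec)
  open import Data.Nat.Tactic.RingSolver using (solve-∀)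
  open import Data.Product using (∃; _×_; _,_)
  open import Data.Sum using (inj₁; inj₂)
  open import Data.Empty using (⊥-elim)
  open import Relation.Nullary using (yes; no)
  open import Relation.Nullary.Decidable using (_×-dec_)
  open import Relation.Binary.PropositionalEquality
  open ≡-Reasoning

  SquareFreeℕ : ℕ → Set
  SquareFreeℕ k = ∀ d → d * d ∣ k → d ≡ 1

  squareFree≢0 : ∀ {k} → SquareFreeℕ k → k ≢ 0
  squareFree≢0 sqf refl with sqf 0 (divides 0 refl)
  ... | ()

  record GcdSplit (m n : ℕ) : Set where
    constructor split
    field
      g m′ n′   : ℕ
      m≡m′g     : m ≡ m′ * g
      n≡n′g     : n ≡ n′ * g
      g≢0       : g ≢ 0
      coprime   : Coprime m′ n′

  gcdSplit : ∀ m n → m ≢ 0 → GcdSplit m n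
  gcdSplit m n m≢0 with gcd[m,n]∣m m n | gcd[m,n]∣n m n
  ... | divides m′ m≡m′g | divides n′ n≡n′g = split (gcd m n) m′ n′ m≡m′g n≡n′g g≢0 coprime
    where
    g≢0 : gcd m n ≢ 0
    g≢0 = gcd[m,n]≢0 m n (inj₁ m≢0)
    coprime : Coprime m′ n′
    coprime {d} (d∣m′ , d∣n′) = ∣1⇒≡1 (*-cancelʳ-∣ (gcd m n) {{ℕ.≢-nonZero g≢0}} dg∣1g)
      where
      dg∣1g : d * gcd m n ∣ 1 * gcd m n
      dg∣1g = subst (d * gcd m n ∣_) (sym (ℕP.*-identityˡ (gcd m n))) (gcd-greatest
        (subst (d * gcd m n ∣_) (sym m≡m′g) (*-monoˡ-∣ (gcd m n) d∣m′))
        (subst (d * gcd m n ∣_) (sym n≡n′g) (*-monoˡ-∣ (gcd m n) d∣n′)))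

  square-of-product : ∀ x g → x * g * (x * g) ≡ g * g * (x * x)
  square-of-product = solve-∀

  -- a² ∣ b² implies a ∣ b: dividing out g = gcd a b leaves coprime a′, b′
  -- with a′² ∣ b′², so a′ ∣ b′ and hence a′ = 1.
  square∣square⇒∣ : ∀ a b → a * a ∣ b * b → a ∣ b
  square∣square⇒∣ zero b 0∣b² with ℕP.m*n≡0⇒m≡0∨n≡0 b (0∣⇒≡0 0∣b²)
  ... | inj₁ refl = ∣-refl
  ... | inj₂ refl = ∣-refl
  square∣square⇒∣ a@(suc _) b a²∣b² with gcdSplit a b (λ ())
  ... | split g a′ b′ a≡a′g b≡b′g g≢0 coprime =
    subst₂ _∣_ (sym (trans a≡a′g (cong (_* g) a′≡1))) (sym b≡b′g) (*-monoˡ-∣ g (1∣ b′))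
    where
    instance
      g≠0 : NonZero g
      g≠0 = ℕ.≢-nonZero g≢0
    a′²∣b′² : a′ * a′ ∣ b′ * b′
    a′²∣b′² = *-cancelˡ-∣ (g * g) {{ℕP.m*n≢0 g g}}
      (subst₂ _∣_ (square-of-product a′ g) (square-of-product b′ g)
        (subst₂ (λ x y → x * x ∣ y * y) a≡a′g b≡b′g a²∣b²))
    a′≡1 : a′ ≡ 1
    a′≡1 = coprime (∣-refl , coprime-divisor coprime (∣-trans (m∣m*n a′) a′²∣b′²))

  -- A square-free divisor of r² divides r: writing k = k′g, r = r′g with
  -- g = gcd k r, coprimality forces k′ ∣ g, so k′² ∣ k and k′ = 1.
  squareFree∣square⇒∣ : ∀ k r → SquareFreeℕ k → k ∣ r * r → k ∣ r
  squareFree∣square⇒∣ k r sqf k∣r² with gcdSplit k r (squareFree≢0 sqf)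
  ... | split g k′ r′ k≡k′g r≡r′g g≢0 coprime =
    subst₂ _∣_ (sym (trans k≡k′g (cong (_* g) k′≡1))) (sym r≡r′g) (*-monoˡ-∣ g (1∣ r′))
    where
    instance
      g≠0 : NonZero g
      g≠0 = ℕ.≢-nonZero g≢0
    k′∣r′r′g : k′ ∣ r′ * (r′ * g)
    k′∣r′r′g = *-cancelˡ-∣ g (subst₂ _∣_ (ℕP.*-comm k′ g) (regroup r′ g)
      (subst₂ (λ x y → x ∣ y * y) k≡k′g r≡r′g k∣r²))
      where
      regroup : ∀ x g → x * g * (x * g) ≡ g * (x * (x * g))
      regroup = solve-∀
    k′∣g : k′ ∣ g
    k′∣g = coprime-divisor coprime (coprime-divisor coprime k′∣r′r′g)
    k′≡1 : k′ ≡ 1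
    k′≡1 = sqf k′ (subst (k′ * k′ ∣_) (sym k≡k′g) (*-monoʳ-∣ k′ k′∣g))

  -- Two square-free numbers whose product is a square are equal: k₁ ∣ r²
  -- gives r = m k₁, hence k₂ = k₁ m², and square-freeness of k₂ gives m = 1.
  squareFree-product-square : ∀ k₁ k₂ r → SquareFreeℕ k₁ → SquareFreeℕ k₂ → k₁ * k₂ ≡ r * r → k₁ ≡ k₂
  squareFree-product-square k₁ k₂ r sqf₁ sqf₂ k₁k₂≡r² =
    cofactor (squareFree∣square⇒∣ k₁ r sqf₁ (subst (k₁ ∣_) k₁k₂≡r² (m∣m*n k₂)))
    where
    instance
      k₁≠0 : NonZero k₁
      k₁≠0 = ℕ.≢-nonZero (squareFree≢0 sqf₁)
    regroup : ∀ m k → m * k * (m * k) ≡ k * (k * (m * m))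
    regroup = solve-∀
    cofactor : k₁ ∣ r → k₁ ≡ k₂
    cofactor (divides m r≡mk₁) = sym (begin
      k₂            ≡⟨ k₂≡k₁m² ⟩
      k₁ * (m * m)  ≡⟨ cong (k₁ *_) m²≡1 ⟩
      k₁ * 1        ≡⟨ ℕP.*-identityʳ k₁ ⟩
      k₁            ∎)
      where
      k₂≡k₁m² : k₂ ≡ k₁ * (m * m)
      k₂≡k₁m² = ℕP.*-cancelˡ-≡ k₂ (k₁ * (m * m)) k₁
        (trans k₁k₂≡r² (trans (cong (λ x → x * x) r≡mk₁) (regroup m k₁)))
      m≡1 : m ≡ 1
      m≡1 = sqf₂ m (divides k₁ k₂≡k₁m²)
      m²≡1 : m * m ≡ 1
      m²≡1 = cong (λ x → x * x) m≡1

  -- Every m ≠ 0 is k·q² with k square-free: repeatedly divide out a square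
  -- factor d² with d ≥ 2 as long as one exists.
  squareFreeDecomposition : ∀ m → m ≢ 0 → ∃ λ k → ∃ λ q → SquareFreeℕ k × m ≡ k * (q * q)
  squareFreeDecomposition = <-rec _ decompose
    where
    BigSquareFactor : ℕ → ℕ → Set
    BigSquareFactor m d = 2 ≤ d × d * d ∣ m
    decompose : ∀ m → (∀ {m′} → m′ < m → m′ ≢ 0 → ∃ λ k → ∃ λ q → SquareFreeℕ k × m′ ≡ k * (q * q)) →
                m ≢ 0 → ∃ λ k → ∃ λ q → SquareFreeℕ k × m ≡ k * (q * q)
    decompose m rec m≢0 with ℕP.anyUpTo? (λ d → (2 ℕP.≤? d) ×-dec (d * d ∣? m)) (suc m)
    ... | no noFactor = m , 1 , squareFree , sym (ℕP.*-identityʳ m)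
      where
      squareFree : SquareFreeℕ m
      squareFree zero    0∣m = ⊥-elim (m≢0 (0∣⇒≡0 0∣m))
      squareFree 1       _   = refl
      squareFree d@(suc (suc _)) d²∣m = ⊥-elim (noFactor (d , s≤s d≤m , s≤s (s≤s z≤n) , d²∣m))
        where
        d≤m : d ≤ m
        d≤m = ℕP.≤-trans (ℕP.m≤m*n d d) (∣⇒≤ {{ℕ.≢-nonZero m≢0}} d²∣m)
    ... | yes (d , _ , 2≤d , divides m′ m≡m′d²) with rec m′<m m′≢0
      where
      m′≢0 : m′ ≢ 0
      m′≢0 refl = m≢0 m≡m′d²
      m′<m : m′ < m
      m′<m = quotient-< (divides m′ m≡m′d²) {{ℕ.n>1⇒nonTrivial 1<d²}} {{ℕ.≢-nonZero m≢0}}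
        where
        1<d² : 1 < d * d
        1<d² = ℕP.<-≤-trans 2≤d (ℕP.m≤m*n d d {{ℕ.>-nonZero (ℕP.<-trans (s≤s z≤n) 2≤d)}})
    ... | k , q , sqf , m′≡kq² = k , q * d , sqf , (begin
      m                    ≡⟨ m≡m′d² ⟩
      m′ * (d * d)         ≡⟨ cong (_* (d * d)) m′≡kq² ⟩
      k * (q * q) * (d * d) ≡⟨ regroup k q d ⟩
      k * (q * d * (q * d)) ∎)
      where
      regroup : ∀ k q d → k * (q * q) * (d * d) ≡ k * (q * d * (q * d))
      regroup = solve-∀

  square-cofactor : ∀ q x y → q ≢ 0 → q * q * x ≡ y * y → ∃ λ w → x ≡ w * w
  square-cofactor q x y q≢0 q²x≡y² with square∣square⇒∣ q y (divides x (trans (sym q²x≡y²) (ℕP.*-comm (q * q) x)))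
  ... | divides w y≡wq = w , ℕP.*-cancelˡ-≡ x (w * w) (q * q) {{ℕP.m*n≢0 q q {{q≠0}} {{q≠0}}}} (begin
    q * q * x      ≡⟨ q²x≡y² ⟩
    y * y          ≡⟨ cong (λ z → z * z) y≡wq ⟩
    w * q * (w * q) ≡⟨ square-of-product w q ⟩
    q * q * (w * w) ∎)
    where
    q≠0 : NonZero q
    q≠0 = ℕ.≢-nonZero q≢0

  between-squares : ∀ m x → m * m < x → x < suc m * suc m → ∀ s → x ≢ s * s
  between-squares m x m²<x x<[m+1]² s refl with ℕP.≤-<-connex s m
  ... | inj₁ s≤m = ℕP.<⇒≱ m²<x (ℕP.*-mono-≤ s≤m s≤m)
  ... | inj₂ m<s = ℕP.<⇒≱ x<[m+1]² (ℕP.*-mono-≤ m<s m<s)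

module IntegerSquares where

  open import Defs
  open SquareClass
  open import Data.Nat as ℕ using (ℕ; zero; suc)
  import Data.Nat.Properties as ℕP
  import Data.Nat.Divisibility as ℕD
  open import Data.Integer as ℤ using (ℤ; +_; -[1+_]; _+_; _-_; _*_; -_; ∣_∣; _≤_)
  import Data.Integer.Properties as ℤP
  open import Data.Integer.Tactic.RingSolver using (solve)
  open import Data.List using (_∷_; [])
  open import Data.Product using (∃; _×_; _,_; proj₁; proj₂)
  open import Data.Sum using (_⊎_; inj₁; inj₂)
  open import Data.Empty using (⊥-elim)
  open import Relation.Nullary using (¬_)
  open import Relation.Binary.PropositionalEquality
  open ≡-Reasoning

  square≡+abs² : ∀ s → s * s ≡ + (∣ s ∣ ℕ.* ∣ s ∣)
  square≡+abs² (+ n)    = ℤP.+◃n≡+n (n ℕ.* n)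
  square≡+abs² -[1+ n ] = refl

  negative-nonSquare : ∀ n → ¬ IsSquare -[1+ n ]
  negative-nonSquare n (s , e) with trans e (square≡+abs² s)
  ... | ()

  squareFree⇒ℕ : ∀ κ → SquareFree κ → SquareFreeℕ ∣ κ ∣
  squareFree⇒ℕ κ sqf d d²∣κ = sqf (+ d) (subst (ℕD._∣ ∣ κ ∣) (sym (ℤP.abs-* (+ d) (+ d))) d²∣κ)

  squareFree⇐ℕ : ∀ k → SquareFreeℕ k → SquareFree (+ k)
  squareFree⇐ℕ k sqf d d²∣k = sqf ∣ d ∣ (subst (ℕD._∣ k) (ℤP.abs-* d d) d²∣k)

  nonNegative-cofactor : ∀ k X y → k ≢ 0 → + (k ℕ.* k) * X ≡ + y → ∃ λ x → X ≡ + x × k ℕ.* k ℕ.* x ≡ y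
  nonNegative-cofactor zero    _        _ k≢0 _ = ⊥-elim (k≢0 refl)
  nonNegative-cofactor (suc k) -[1+ _ ] _ _   ()
  nonNegative-cofactor (suc k) (+ x)    y _   k²x≡y = x , refl , ℤP.+-injective (trans (ℤP.pos-* (suc k ℕ.* suc k) x) k²x≡y)

  square-cofactorℤ : ∀ κ X Y → κ ≢ + 0 → κ * κ * X ≡ Y * Y → IsSquare X
  square-cofactorℤ κ X Y κ≢0 κ²X≡Y² = squareRoot (nonNegative-cofactor ∣ κ ∣ X (∣ Y ∣ ℕ.* ∣ Y ∣) ∣κ∣≢0 κ²X≡∣Y∣²)
    where
    ∣κ∣≢0 : ∣ κ ∣ ≢ 0
    ∣κ∣≢0 ∣κ∣≡0 = κ≢0 (ℤP.∣i∣≡0⇒i≡0 ∣κ∣≡0)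
    κ²X≡∣Y∣² : + (∣ κ ∣ ℕ.* ∣ κ ∣) * X ≡ + (∣ Y ∣ ℕ.* ∣ Y ∣)
    κ²X≡∣Y∣² = trans (cong (_* X) (sym (square≡+abs² κ))) (trans κ²X≡Y² (square≡+abs² Y))
    squareRoot : (∃ λ x → X ≡ + x × ∣ κ ∣ ℕ.* ∣ κ ∣ ℕ.* x ≡ ∣ Y ∣ ℕ.* ∣ Y ∣) → IsSquare X
    squareRoot (x , X≡x , κ²x≡Y²) with square-cofactor (∣ κ ∣) x (∣ Y ∣) ∣κ∣≢0 κ²x≡Y²
    ... | w , x≡w² = + w , trans X≡x (trans (cong +_ x≡w²) (ℤP.pos-* w w))

  equal-squares : ∀ κ d → κ * κ ≡ d * d → d ≡ κ ⊎ d ≡ - κ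
  equal-squares κ d κ²≡d² with ℤP.i*j≡0⇒i≡0∨j≡0 (d - κ) {d + κ} (begin
    (d - κ) * (d + κ)   ≡⟨ solve (d ∷ κ ∷ []) ⟩
    d * d - κ * κ       ≡⟨ cong (λ v → d * d - v) κ²≡d² ⟩
    d * d - d * d       ≡⟨ ℤP.+-inverseʳ (d * d) ⟩
    + 0                 ∎)
  ... | inj₁ d-κ≡0 = inj₁ (ℤP.i-j≡0⇒i≡j d κ d-κ≡0)
  ... | inj₂ d+κ≡0 = inj₂ (ℤP.i-j≡0⇒i≡j d (- κ) (trans (cong (λ v → d + v) (ℤP.neg-involutive κ)) d+κ≡0))

  -- The square class of a positive integer X: the unique square-free A
  -- with AX a square.  It exists since X = k q² with k square-free (take
  -- A = k), and is unique because κX = s² gives q² ∣ s², so κk is a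
  -- square and κ = k.
  record IsSquareClass (X A : ℤ) : Set where
    constructor squareClassWith
    field
      squareFree : SquareFree A
      square     : IsSquare (A * X)
      unique     : ∀ κ → SquareFree κ → IsSquare (κ * X) → κ ≡ A

  squareClass : ∀ x → ∃ λ A → + 1 ≤ A × IsSquareClass (+ suc x) A
  squareClass x = fromDecomposition (squareFreeDecomposition (suc x) (λ ()))
    where
    open import Data.Nat.Tactic.RingSolver using (solve-∀)
    fromDecomposition : (∃ λ k → ∃ λ q → SquareFreeℕ k × suc x ≡ k ℕ.* (q ℕ.* q)) →
                        ∃ λ A → + 1 ≤ A × IsSquareClass (+ suc x) A
    fromDecomposition (k , q , sqf , 1+x≡kq²) = + k , ℤ.+≤+ 1≤k , squareClassWith (squareFree⇐ℕ k sqf) kX-square unique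
      where
      1≤k : 1 ℕ.≤ k
      1≤k = ℕP.n≢0⇒n>0 (squareFree≢0 sqf)
      q≢0 : q ≢ 0
      q≢0 q≡0 = ℕP.1+n≢0 (trans 1+x≡kq² (trans (cong (λ q → k ℕ.* (q ℕ.* q)) q≡0) (ℕP.*-zeroʳ k)))
      regroup₁ : ∀ k q → k ℕ.* (k ℕ.* (q ℕ.* q)) ≡ k ℕ.* q ℕ.* (k ℕ.* q)
      regroup₁ = solve-∀
      kX-square : IsSquare (+ k * + suc x)
      kX-square = + (k ℕ.* q) , (begin
        + k * + suc x               ≡⟨ sym (ℤP.pos-* k (suc x)) ⟩
        + (k ℕ.* suc x)             ≡⟨ cong (λ n → + (k ℕ.* n)) 1+x≡kq² ⟩
        + (k ℕ.* (k ℕ.* (q ℕ.* q))) ≡⟨ cong +_ (regroup₁ k q) ⟩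
        + (k ℕ.* q ℕ.* (k ℕ.* q))   ≡⟨ ℤP.pos-* (k ℕ.* q) (k ℕ.* q) ⟩
        + (k ℕ.* q) * + (k ℕ.* q)   ∎)
      regroup₂ : ∀ q c k → q ℕ.* q ℕ.* (c ℕ.* k) ≡ c ℕ.* (k ℕ.* (q ℕ.* q))
      regroup₂ = solve-∀
      unique : ∀ κ → SquareFree κ → IsSquare (κ * + suc x) → κ ≡ + k
      unique -[1+ n ] _    κX-square = ⊥-elim (negative-nonSquare _ κX-square)
      unique (+ c)    sqfc (s , cX≡s²) =
        cong +_ (squareFree-product-square c k (proj₁ ck-square) (squareFree⇒ℕ (+ c) sqfc) sqf (proj₂ ck-square))
        where
        ck-square : ∃ λ w → c ℕ.* k ≡ w ℕ.* w
        ck-square = square-cofactor q (c ℕ.* k) (∣ s ∣) q≢0 (begin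
          q ℕ.* q ℕ.* (c ℕ.* k)     ≡⟨ regroup₂ q c k ⟩
          c ℕ.* (k ℕ.* (q ℕ.* q))   ≡⟨ cong (c ℕ.*_) (sym 1+x≡kq²) ⟩
          c ℕ.* suc x               ≡⟨ ℤP.+-injective (trans (ℤP.pos-* c (suc x)) (trans cX≡s² (square≡+abs² s))) ⟩
          ∣ s ∣ ℕ.* ∣ s ∣            ∎)

module QuadraticField where

  open import Defs
  open import Data.Nat as ℕ using (ℕ; zero; suc)
  import Data.Nat.Properties as ℕP
  open import Data.Nat.Coprimality using (Coprime)
  open import Data.Nat.Divisibility using (∣1⇒≡1)
  open import Data.Integer as ℤ using (ℤ; +_; -[1+_])
  import Data.Integer.Properties as ℤP
  open import Data.Rational as ℚ using (ℚ; mkℚ; 0ℚ; 1ℚ; ½; _<_; _≤_; _+_; _-_; _*_; -_)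
  import Data.Rational.Properties as ℚP
  open import Data.Rational.Solver using (module +-*-Solver)
  open +-*-Solver
  open import Data.Product using (∃; _×_; _,_; proj₁; proj₂)
  open import Data.Sum using (_⊎_; inj₁; inj₂)
  open import Data.Empty using (⊥; ⊥-elim)
  open import Relation.Nullary using (¬_)
  open import Relation.Binary.PropositionalEquality
  open import Relation.Binary.Definitions using (tri<; tri≈; tri>)

  coprime-1 : ∀ n → Coprime n 1
  coprime-1 n (_ , d∣1) = ∣1⇒≡1 d∣1

  fromℤ-canonical : ∀ z → fromℤ z ≡ mkℚ z 0 (coprime-1 ℤ.∣ z ∣)
  fromℤ-canonical (+ n)    = ℚP.normalize-coprime (coprime-1 n)
  fromℤ-canonical -[1+ n ] = cong -_ (ℚP.normalize-coprime (coprime-1 (suc n)))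

  fromℤ-+ : ∀ x y → fromℤ (x ℤ.+ y) ≡ fromℤ x + fromℤ y
  fromℤ-+ x y rewrite fromℤ-canonical x | fromℤ-canonical y =
    cong fromℤ (cong₂ ℤ._+_ (sym (ℤP.*-identityʳ x)) (sym (ℤP.*-identityʳ y)))

  fromℤ-* : ∀ x y → fromℤ (x ℤ.* y) ≡ fromℤ x * fromℤ y
  fromℤ-* x y rewrite fromℤ-canonical x | fromℤ-canonical y = refl

  fromℤ-injective : ∀ x y → fromℤ x ≡ fromℤ y → x ≡ y
  fromℤ-injective x y e = cong ℚ.↥_ (trans (sym (fromℤ-canonical x)) (trans e (fromℤ-canonical y)))

  fromℤ-<-reflects : ∀ x y → fromℤ x < fromℤ y → x ℤ.< y
  fromℤ-<-reflects x y x<y with subst₂ _<_ (fromℤ-canonical x) (fromℤ-canonical y) x<y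
  ... | ℚ.*<* x*1<y*1 = subst₂ ℤ._<_ (ℤP.*-identityʳ x) (ℤP.*-identityʳ y) x*1<y*1

  fromℤ-<-preserves : ∀ x y → x ℤ.< y → fromℤ x < fromℤ y
  fromℤ-<-preserves x y x<y = subst₂ _<_ (sym (fromℤ-canonical x)) (sym (fromℤ-canonical y))
    (ℚ.*<* (subst₂ ℤ._<_ (sym (ℤP.*-identityʳ x)) (sym (ℤP.*-identityʳ y)) x<y))

  private
    variable
      x y : ℚ

  <⇒0<- : x < y → 0ℚ < y - x
  <⇒0<- {x} {y} x<y = subst (_< y - x) (ℚP.+-inverseʳ x) (ℚP.+-monoˡ-< (- x) x<y)

  0<-⇒< : 0ℚ < y - x → x < y
  0<-⇒< {y} {x} 0<y-x = subst₂ _<_ (ℚP.+-identityˡ x) (solve 2 (λ y x → (y :- x) :+ x := y) refl y x)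
    (ℚP.+-monoˡ-< x 0<y-x)

  ≤⇒0≤- : x ≤ y → 0ℚ ≤ y - x
  ≤⇒0≤- {x} {y} x≤y = subst (_≤ y - x) (ℚP.+-inverseʳ x) (ℚP.+-monoˡ-≤ (- x) x≤y)

  pos+pos : 0ℚ < x → 0ℚ < y → 0ℚ < x + y
  pos+pos {x} {y} 0<x 0<y = subst (_< x + y) (ℚP.+-identityˡ 0ℚ) (ℚP.+-mono-< 0<x 0<y)

  nonNeg+pos : 0ℚ ≤ x → 0ℚ < y → 0ℚ < x + y
  nonNeg+pos {x} {y} 0≤x 0<y = subst (_< x + y) (ℚP.+-identityˡ 0ℚ) (ℚP.+-mono-≤-< 0≤x 0<y)

  nonNeg+nonNeg : 0ℚ ≤ x → 0ℚ ≤ y → 0ℚ ≤ x + y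
  nonNeg+nonNeg {x} {y} 0≤x 0≤y = subst (_≤ x + y) (ℚP.+-identityˡ 0ℚ) (ℚP.+-mono-≤ 0≤x 0≤y)

  pos*pos : 0ℚ < x → 0ℚ < y → 0ℚ < x * y
  pos*pos {x} {y} 0<x 0<y = ℚP.positive⁻¹ (x * y) {{ℚP.pos*pos⇒pos x {{ℚ.positive 0<x}} y {{ℚ.positive 0<y}}}}

  nonNeg*nonNeg : 0ℚ ≤ x → 0ℚ ≤ y → 0ℚ ≤ x * y
  nonNeg*nonNeg {x} {y} 0≤x 0≤y =
    ℚP.nonNegative⁻¹ (x * y) {{ℚP.nonNeg*nonNeg⇒nonNeg x {{ℚ.nonNegative 0≤x}} y {{ℚ.nonNegative 0≤y}}}}

  square-nonNeg : ∀ x → 0ℚ ≤ x * x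
  square-nonNeg x with ℚP.≤-total 0ℚ x
  ... | inj₁ 0≤x = nonNeg*nonNeg 0≤x 0≤x
  ... | inj₂ x≤0 = subst (0ℚ ≤_) (solve 1 (λ x → (:- x) :* (:- x) := x :* x) refl x)
                     (nonNeg*nonNeg (ℚP.neg-antimono-≤ x≤0) (ℚP.neg-antimono-≤ x≤0))

  pos⇒≢0 : 0ℚ < x → x ≢ 0ℚ
  pos⇒≢0 0<x refl = ℚP.<-irrefl refl 0<x

  nonNeg∧≢0⇒pos : 0ℚ ≤ x → x ≢ 0ℚ → 0ℚ < x
  nonNeg∧≢0⇒pos {x} 0≤x x≢0 with ℚP.<-cmp 0ℚ x
  ... | tri< 0<x _ _ = 0<x
  ... | tri≈ _ 0≡x _ = ⊥-elim (x≢0 (sym 0≡x))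
  ... | tri> _ _ x<0 = ⊥-elim (ℚP.<-irrefl refl (ℚP.≤-<-trans 0≤x x<0))

  0<1 : 0ℚ < 1ℚ
  0<1 = ℚ.*<* (ℤ.+<+ (ℕ.s≤s ℕ.z≤n))

  0<½ : 0ℚ < ½
  0<½ = ℚ.*<* (ℤ.+<+ (ℕ.s≤s ℕ.z≤n))

  vanishing-term : ∀ {p q l r : ℚ} c → p ≡ q + c * (l - r) → l ≡ r → p ≡ q
  vanishing-term {q = q} {r = r} c p≡ refl = trans p≡ (solve 3 (λ q c r → q :+ c :* (r :- r) := q) refl q c r)

  module Arithmetic (N : ℤ) where

    infixl 7 _·_
    _·_ : K → K → K
    _·_ = mulK N

    private
      N′ = fromℤ N

    ·-assoc : ∀ x y z → x · (y · z) ≡ (x · y) · z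
    ·-assoc (a , b) (c , d) (e , f) = cong₂ _,_
      (solve 7 (λ a b c d e f N → a :* (c :* e :+ N :* (d :* f)) :+ N :* (b :* (c :* f :+ d :* e)) :=
         (a :* c :+ N :* (b :* d)) :* e :+ N :* ((a :* d :+ b :* c) :* f)) refl a b c d e f N′)
      (solve 7 (λ a b c d e f N → a :* (c :* f :+ d :* e) :+ b :* (c :* e :+ N :* (d :* f)) :=
         (a :* c :+ N :* (b :* d)) :* f :+ (a :* d :+ b :* c) :* e) refl a b c d e f N′)

    ·-comm : ∀ x y → x · y ≡ y · x
    ·-comm (a , b) (c , d) = cong₂ _,_
      (solve 5 (λ a b c d N → a :* c :+ N :* (b :* d) := c :* a :+ N :* (d :* b)) refl a b c d N′)
      (solve 4 (λ a b c d → a :* d :+ b :* c := c :* b :+ d :* a) refl a b c d)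

    ·-identityˡ : ∀ x → oneK · x ≡ x
    ·-identityˡ (a , b) = cong₂ _,_
      (solve 3 (λ a b N → con 1ℚ :* a :+ N :* (con 0ℚ :* b) := a) refl a b N′)
      (solve 2 (λ a b → con 1ℚ :* b :+ con 0ℚ :* a := b) refl a b)

    ·-identityʳ : ∀ x → x · oneK ≡ x
    ·-identityʳ x = trans (·-comm x oneK) (·-identityˡ x)

    neg-·-neg : ∀ x y → negK x · negK y ≡ x · y
    neg-·-neg (a , b) (c , d) = cong₂ _,_
      (solve 5 (λ a b c d N → (:- a) :* (:- c) :+ N :* ((:- b) :* (:- d)) := a :* c :+ N :* (b :* d)) refl a b c d N′)
      (solve 4 (λ a b c d → (:- a) :* (:- d) :+ (:- b) :* (:- c) := a :* d :+ b :* c) refl a b c d)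

    square-· : ∀ x y → (x · y) · (x · y) ≡ (x · x) · (y · y)
    square-· x y = begin
      (x · y) · (x · y) ≡⟨ sym (·-assoc x y (x · y)) ⟩
      x · (y · (x · y)) ≡⟨ cong (x ·_) (·-assoc y x y) ⟩
      x · ((y · x) · y) ≡⟨ cong (λ z → x · (z · y)) (·-comm y x) ⟩
      x · ((x · y) · y) ≡⟨ cong (x ·_) (sym (·-assoc x y y)) ⟩
      x · (x · (y · y)) ≡⟨ ·-assoc x x (y · y) ⟩
      (x · x) · (y · y) ∎
      where open ≡-Reasoning

    pow-+ : ∀ x j k → powK N x (j ℕ.+ k) ≡ powK N x j · powK N x k
    pow-+ x zero    k = sym (·-identityˡ (powK N x k))
    pow-+ x (suc j) k = trans (cong (x ·_) (pow-+ x j k)) (·-assoc x (powK N x j) (powK N x k))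

    norm-· : ∀ x y → normK N (x · y) ≡ normK N x * normK N y
    norm-· (a , b) (c , d) = solve 5 (λ a b c d N →
      (a :* c :+ N :* (b :* d)) :* (a :* c :+ N :* (b :* d)) :- N :* ((a :* d :+ b :* c) :* (a :* d :+ b :* c))
      := (a :* a :- N :* (b :* b)) :* (c :* c :- N :* (d :* d))) refl a b c d N′

  -- The norm of a unit is ±1: it is an integer with an integer inverse.
  norm-unit : ∀ N x n → normK N x ≡ fromℤ n → IsUnitO N x → n ≡ + 1 ⊎ n ≡ -[1+ 0 ]
  norm-unit N x n ‖x‖≡n (_ , y , (_ , m , ‖y‖≡m) , xy≡1) = ±1 n m (fromℤ-injective (n ℤ.* m) (+ 1) (begin
    fromℤ (n ℤ.* m)          ≡⟨ fromℤ-* n m ⟩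
    fromℤ n * fromℤ m        ≡⟨ cong₂ _*_ (sym ‖x‖≡n) (sym ‖y‖≡m) ⟩
    normK N x * normK N y    ≡⟨ sym (Arithmetic.norm-· N x y) ⟩
    normK N (mulK N x y)     ≡⟨ cong (normK N) xy≡1 ⟩
    normK N oneK             ≡⟨ solve 1 (λ N → con 1ℚ :* con 1ℚ :- N :* (con 0ℚ :* con 0ℚ) := con 1ℚ) refl (fromℤ N) ⟩
    fromℤ (+ 1)              ∎))
    where
    open ≡-Reasoning
    ±1 : ∀ n m → n ℤ.* m ≡ + 1 → n ≡ + 1 ⊎ n ≡ -[1+ 0 ]
    ±1 n m nm≡1 with ℕP.m*n≡1⇒m≡1 ℤ.∣ n ∣ ℤ.∣ m ∣ (trans (sym (ℤP.abs-* n m)) (cong ℤ.∣_∣ nm≡1))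
    ±1 (+ .1)    m _ | refl = inj₁ refl
    ±1 -[1+ 0 ] m _ | refl = inj₂ refl

  -- The
  -- quantity D = Nb² − (1 − a)² equals 2a − (1 + σ) by the norm equation,
  -- and every reading of "1 − a < b√N" gives a > 1 or D > 0.
  excess≡D : ∀ N a b σ → a * a - fromℤ N * (b * b) ≡ σ →
    a + a - (1ℚ + σ) ≡ fromℤ N * (b * b) - (1ℚ - a) * (1ℚ - a)
  excess≡D N a b σ ‖ε‖≡σ = vanishing-term 1ℚ (solve 4 (λ a b N σ →
    a :+ a :- (con 1ℚ :+ σ)
      := N :* (b :* b) :- (con 1ℚ :- a) :* (con 1ℚ :- a) :+ con 1ℚ :* ((a :* a :- N :* (b :* b)) :- σ))
    refl a b (fromℤ N) σ) ‖ε‖≡σ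

  a>1⇒excess : ∀ a σ → σ ≤ 1ℚ → 1ℚ - a < 0ℚ → 0ℚ < a + a - (1ℚ + σ)
  a>1⇒excess a σ σ≤1 1-a<0 =
    subst (0ℚ <_) (solve 2 (λ a σ → (con 1ℚ :- σ) :+ ((con 0ℚ :- (con 1ℚ :- a)) :+ (con 0ℚ :- (con 1ℚ :- a)))
                                     := a :+ a :- (con 1ℚ :+ σ)) refl a σ)
      (nonNeg+pos (≤⇒0≤- σ≤1) (pos+pos (<⇒0<- 1-a<0) (<⇒0<- 1-a<0)))

  trace>1+norm : ∀ N a b σ → σ ≤ 1ℚ → a * a - fromℤ N * (b * b) ≡ σ → GtOne N (a , b) →
    0ℚ < a + a - (1ℚ + σ)
  trace>1+norm N a b σ σ≤1 ‖ε‖≡σ (inj₁ (_ , inj₁ 1-a<0))     = a>1⇒excess a σ σ≤1 1-a<0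
  trace>1+norm N a b σ σ≤1 ‖ε‖≡σ (inj₂ (_ , 1-a<0 , _))      = a>1⇒excess a σ σ≤1 1-a<0
  trace>1+norm N a b σ σ≤1 ‖ε‖≡σ (inj₁ (_ , inj₂ [1-a]²<Nb²)) =
    subst (0ℚ <_) (sym (excess≡D N a b σ ‖ε‖≡σ)) (<⇒0<- [1-a]²<Nb²)
  -- For norm 1 moreover b > 0: with D = 2a − 2 > 0, b < 0 would give
  -- Nb² < (1 − a)², i.e. D < 0, and b = 0 would give D = −(1 − a)² ≤ 0.
  norm1⇒b>0 : ∀ N a b → a * a - fromℤ N * (b * b) ≡ 1ℚ → GtOne N (a , b) → 0ℚ < b
  norm1⇒b>0 N a b ‖ε‖≡1 ε>1 = sign ε>1
    where
    N′ = fromℤ N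
    D>0 : 0ℚ < N′ * (b * b) - (1ℚ - a) * (1ℚ - a)
    D>0 = subst (0ℚ <_) (excess≡D N a b 1ℚ ‖ε‖≡1) (trace>1+norm N a b 1ℚ ℚP.≤-refl ‖ε‖≡1 ε>1)
    b≢0 : b ≢ 0ℚ
    b≢0 refl = pos⇒≢0 (nonNeg+pos (square-nonNeg (1ℚ - a)) D>0)
      (solve 2 (λ a N → (con 1ℚ :- a) :* (con 1ℚ :- a) :+ (N :* (con 0ℚ :* con 0ℚ) :- (con 1ℚ :- a) :* (con 1ℚ :- a))
                       := con 0ℚ) refl a N′)
    sign : GtOne N (a , b) → 0ℚ < b
    sign (inj₁ (0≤b , _)) = nonNeg∧≢0⇒pos 0≤b b≢0
    sign (inj₂ (_ , _ , Nb²<[1-a]²)) = ⊥-elim (pos⇒≢0 (pos+pos D>0 (<⇒0<- Nb²<[1-a]²))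
      (solve 2 (λ u v → (u :- v) :+ (v :- u) := con 0ℚ) refl (N′ * (b * b)) ((1ℚ - a) * (1ℚ - a))))

  -- The powers of ε = a + b√N with a > 1, b > 0 and N > 0 have strictly
  -- increasing b-coordinates (all coordinates stay ≥ 1 resp. ≥ 0), so
  -- m ↦ εᵐ is injective.
  module Powers (N : ℤ) (a b : ℚ) (a>1 : 0ℚ < a - 1ℚ) (b>0 : 0ℚ < b) (N>0 : 0ℚ < fromℤ N) where

    open Arithmetic N

    private
      N′ = fromℤ N
      ε = (a , b)

    coord₁ coord₂ : ℕ → ℚ
    coord₁ m = proj₁ (powK N ε m)
    coord₂ m = proj₂ (powK N ε m)

    private
      a≥0 : 0ℚ ≤ a
      a≥0 = ℚP.<⇒≤ (subst (0ℚ <_) (solve 1 (λ a → a :- con 1ℚ :+ con 1ℚ := a) refl a) (pos+pos a>1 0<1))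

    coords≥ : ∀ m → 0ℚ ≤ coord₁ m - 1ℚ × 0ℚ ≤ coord₂ m
    coords≥ zero    = ℚP.≤-reflexive (sym (ℚP.+-inverseʳ 1ℚ)) , ℚP.≤-refl
    coords≥ (suc m) with powK N ε m | coords≥ m
    ... | (c , d) | (c≥1 , d≥0) =
      subst (0ℚ ≤_) (solve 5 (λ a b c d N → (a :- con 1ℚ) :* (c :- con 1ℚ :+ con 1ℚ) :+ (c :- con 1ℚ) :+ N :* (b :* d)
                                := (a :* c :+ N :* (b :* d)) :- con 1ℚ) refl a b c d N′)
        (nonNeg+nonNeg (nonNeg+nonNeg (nonNeg*nonNeg (ℚP.<⇒≤ a>1) c≥0) c≥1)
                       (nonNeg*nonNeg (ℚP.<⇒≤ N>0) (nonNeg*nonNeg (ℚP.<⇒≤ b>0) d≥0))) ,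
      nonNeg+nonNeg (nonNeg*nonNeg a≥0 d≥0)
                    (nonNeg*nonNeg (ℚP.<⇒≤ b>0) (subst (0ℚ ≤_) (solve 1 (λ c → c :- con 1ℚ :+ con 1ℚ := c) refl c) c≥0))
      where
      c≥0 : 0ℚ ≤ c - 1ℚ + 1ℚ
      c≥0 = nonNeg+nonNeg c≥1 (ℚP.<⇒≤ 0<1)

    coord₂-step : ∀ m → coord₂ m < coord₂ (suc m)
    coord₂-step m with powK N ε m | coords≥ m
    ... | (c , d) | (c≥1 , d≥0) = 0<-⇒< (subst (0ℚ <_)
      (solve 4 (λ a b c d → (a :- con 1ℚ) :* d :+ b :* (c :- con 1ℚ :+ con 1ℚ) := (a :* d :+ b :* c) :- d) refl a b c d)
      (nonNeg+pos (nonNeg*nonNeg (ℚP.<⇒≤ a>1) d≥0) (pos*pos b>0 (nonNeg+pos c≥1 0<1))))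

    coord₂-increasing : ∀ m k → coord₂ m < coord₂ (suc (k ℕ.+ m))
    coord₂-increasing m zero    = coord₂-step m
    coord₂-increasing m (suc k) = ℚP.<-trans (coord₂-increasing m k) (coord₂-step (suc (k ℕ.+ m)))

    pow-injective : ∀ j k → powK N ε j ≡ powK N ε k → j ≡ k
    pow-injective j k εʲ≡εᵏ with ℕP.<-cmp j k
    ... | tri≈ _ j≡k _ = j≡k
    ... | tri< (ℕ.s≤s {n = k′} j≤k′) _ _ = ⊥-elim (ℚP.<-irrefl (cong proj₂ εʲ≡εᵏ)
            (subst (λ i → coord₂ j < coord₂ i) (cong suc (ℕP.m∸n+n≡m j≤k′)) (coord₂-increasing j (k′ ℕ.∸ j))))
    ... | tri> _ _ (ℕ.s≤s {n = j′} k≤j′) = ⊥-elim (ℚP.<-irrefl (sym (cong proj₂ εʲ≡εᵏ))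
            (subst (λ i → coord₂ k < coord₂ i) (cong suc (ℕP.m∸n+n≡m k≤j′)) (coord₂-increasing k (j′ ℕ.∸ k))))

    -- Hence ε, if it generates all units up to sign, has no square root
    -- among the units: η = ±εᵐ would give ε = ε²ᵐ, and ηεᵐ = ±1 would
    -- give ε²ᵐ⁺¹ = 1.
    no-unit-square-root : (∀ η → IsUnitO N η → ∃ λ m →
        (η ≡ powK N ε m) ⊎ (η ≡ negK (powK N ε m)) ⊎ (η · powK N ε m ≡ oneK) ⊎ (η · powK N ε m ≡ negK oneK)) →
      ∀ η → IsUnitO N η → η · η ≡ ε → ⊥
    no-unit-square-root generates η unit η²≡ε = refute (generates η unit)
      where
      open ≡-Reasoning
      even≢1 : ∀ m → 1 ≢ m ℕ.+ m
      even≢1 zero    ()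
      even≢1 (suc m) 1≡2+2m with trans (cong ℕ.pred 1≡2+2m) (ℕP.+-suc m m)
      ... | ()
      ε≡ε²ᵐ : ∀ m → η · η ≡ powK N ε m · powK N ε m → 1 ≡ m ℕ.+ m
      ε≡ε²ᵐ m η²≡εᵐεᵐ = pow-injective 1 (m ℕ.+ m)
        (trans (·-identityʳ ε) (trans (sym η²≡ε) (trans η²≡εᵐεᵐ (sym (pow-+ ε m m)))))
      ε²ᵐ⁺¹≢1 : ∀ m → (η · powK N ε m) · (η · powK N ε m) ≡ oneK → ⊥
      ε²ᵐ⁺¹≢1 m ηεᵐ²≡1 = ℕP.1+n≢0 (pow-injective (suc (m ℕ.+ m)) 0 (begin
        ε · powK N ε (m ℕ.+ m)              ≡⟨ cong₂ _·_ (sym η²≡ε) (pow-+ ε m m) ⟩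
        (η · η) · (powK N ε m · powK N ε m) ≡⟨ sym (square-· η (powK N ε m)) ⟩
        (η · powK N ε m) · (η · powK N ε m) ≡⟨ ηεᵐ²≡1 ⟩
        oneK                                ∎))
      refute : (∃ λ m → (η ≡ powK N ε m) ⊎ (η ≡ negK (powK N ε m)) ⊎
                        (η · powK N ε m ≡ oneK) ⊎ (η · powK N ε m ≡ negK oneK)) → ⊥
      refute (m , inj₁ η≡εᵐ)                 = even≢1 m (ε≡ε²ᵐ m (cong₂ _·_ η≡εᵐ η≡εᵐ))
      refute (m , inj₂ (inj₁ η≡-εᵐ))         =
        even≢1 m (ε≡ε²ᵐ m (trans (cong₂ _·_ η≡-εᵐ η≡-εᵐ) (neg-·-neg (powK N ε m) (powK N ε m))))
      refute (m , inj₂ (inj₂ (inj₁ ηεᵐ≡1)))  = ε²ᵐ⁺¹≢1 m (trans (cong₂ _·_ ηεᵐ≡1 ηεᵐ≡1) (·-identityˡ oneK))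
      refute (m , inj₂ (inj₂ (inj₂ ηεᵐ≡-1))) =
        ε²ᵐ⁺¹≢1 m (trans (cong₂ _·_ ηεᵐ≡-1 ηεᵐ≡-1) (trans (neg-·-neg oneK oneK) (·-identityˡ oneK)))

  -- If ε = a + b√N has norm 1 and trace
  -- t with t + 2σ = s² (σ = ±1, s ≠ 0), then η = s/2 + (b/s)√N is a unit
  -- of norm σ (its trace is s, and ση̄ is its inverse) with η² = ε:
  -- indeed a = (s² − 2σ)/2 and Nb² = a² − 1 = s²(s² − 4σ)/4.
  module SquareRoot (N : ℤ) (a b : ℚ) (t σz s : ℤ)
                    (‖ε‖≡1 : a * a - fromℤ N * (b * b) ≡ 1ℚ) (trε≡t : a + a ≡ fromℤ t)
                    (σ²≡1 : σz ℤ.* σz ≡ + 1) (s≢0 : s ≢ + 0) (t+2σ≡s² : t ℤ.+ + 2 ℤ.* σz ≡ s ℤ.* s) where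

    open ≡-Reasoning

    private
      N′ = fromℤ N
      σ  = fromℤ σz
      S  = fromℤ s
      two = fromℤ (+ 2)
      four = fromℤ (+ 4)

      instance
        S≢0 : ℚ.NonZero S
        S≢0 = ℚ.≢-nonZero (λ S≡0 → s≢0 (fromℤ-injective s (+ 0) S≡0))

      inv = ℚ.1/ S

      inv*S≡1 : inv * S ≡ 1ℚ
      inv*S≡1 = ℚP.*-inverseˡ S

      σ*σ≡1 : σ * σ ≡ 1ℚ
      σ*σ≡1 = trans (sym (fromℤ-* σz σz)) (cong fromℤ σ²≡1)

      a≡[S²-2σ]/2 : a ≡ (S * S - two * σ) * ½
      a≡[S²-2σ]/2 = begin
        a                              ≡⟨ solve 1 (λ a → a := (a :+ a) :* con ½) refl a ⟩
        (a + a) * ½                    ≡⟨ cong (_* ½) trε≡t ⟩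
        fromℤ t * ½                    ≡⟨ solve 2 (λ T σ → T :* con ½ := ((T :+ con two :* σ) :- con two :* σ) :* con ½) refl (fromℤ t) σ ⟩
        (fromℤ t + two * σ - two * σ) * ½ ≡⟨ cong (λ x → (x - two * σ) * ½) t+2σ≡S² ⟩
        (S * S - two * σ) * ½          ∎
        where
        t+2σ≡S² : fromℤ t + two * σ ≡ S * S
        t+2σ≡S² = begin
          fromℤ t + two * σ                   ≡⟨ cong (λ x → fromℤ t + x) (sym (fromℤ-* (+ 2) σz)) ⟩
          fromℤ t + fromℤ (+ 2 ℤ.* σz)        ≡⟨ sym (fromℤ-+ t (+ 2 ℤ.* σz)) ⟩
          fromℤ (t ℤ.+ + 2 ℤ.* σz)            ≡⟨ cong fromℤ t+2σ≡s² ⟩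
          fromℤ (s ℤ.* s)                     ≡⟨ fromℤ-* s s ⟩
          S * S                               ∎

      e₁ = S * ½
      e₂ = b * inv

      Nb²/S² : N′ * (e₂ * e₂) ≡ (S * S - four * σ) * (½ * ½)
      Nb²/S² = begin
        N′ * (b * inv * (b * inv))
          ≡⟨ solve 3 (λ b inv N → N :* ((b :* inv) :* (b :* inv)) := (N :* (b :* b)) :* (inv :* inv)) refl b inv N′ ⟩
        N′ * (b * b) * (inv * inv)
          ≡⟨ cong (_* (inv * inv)) Nb²≡A²-1 ⟩
        (A * A - 1ℚ) * (inv * inv)
          ≡⟨ solve 3 (λ S inv σ → (((S :* S :- con two :* σ) :* con ½) :* ((S :* S :- con two :* σ) :* con ½) :- con 1ℚ) :* (inv :* inv)
                := (S :* S :- con four :* σ) :* (con ½ :* con ½) :* ((inv :* S) :* (inv :* S)) :+ (σ :* σ :- con 1ℚ) :* (inv :* inv)) refl S inv σ ⟩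
        (S * S - four * σ) * (½ * ½) * ((inv * S) * (inv * S)) + (σ * σ - 1ℚ) * (inv * inv)
          ≡⟨ cong₂ (λ x y → (S * S - four * σ) * (½ * ½) * (x * x) + (y - 1ℚ) * (inv * inv)) inv*S≡1 σ*σ≡1 ⟩
        (S * S - four * σ) * (½ * ½) * (1ℚ * 1ℚ) + (1ℚ - 1ℚ) * (inv * inv)
          ≡⟨ solve 3 (λ S σ inv → (S :* S :- con four :* σ) :* (con ½ :* con ½) :* (con 1ℚ :* con 1ℚ) :+ (con 1ℚ :- con 1ℚ) :* (inv :* inv)
                := (S :* S :- con four :* σ) :* (con ½ :* con ½)) refl S σ inv ⟩
        (S * S - four * σ) * (½ * ½) ∎
        where
        A = (S * S - two * σ) * ½
        Nb²≡A²-1 : N′ * (b * b) ≡ A * A - 1ℚ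
        Nb²≡A²-1 = begin
          N′ * (b * b)                    ≡⟨ solve 3 (λ a b N → N :* (b :* b) := a :* a :- (a :* a :- N :* (b :* b))) refl a b N′ ⟩
          a * a - (a * a - N′ * (b * b))  ≡⟨ cong₂ (λ x y → x * x - y) a≡[S²-2σ]/2 ‖ε‖≡1 ⟩
          A * A - 1ℚ                      ∎

    η η⁻¹ : K
    η   = (e₁ , e₂)
    η⁻¹ = (σ * e₁ , - (σ * e₂))

    norm-η : normK N η ≡ σ
    norm-η = trans (cong (λ x → e₁ * e₁ - x) Nb²/S²)
      (solve 2 (λ S σ → S :* con ½ :* (S :* con ½) :- (S :* S :- con four :* σ) :* (con ½ :* con ½) := σ) refl S σ)

    norm-η⁻¹ : normK N η⁻¹ ≡ σ
    norm-η⁻¹ = begin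
      σ * e₁ * (σ * e₁) - N′ * (- (σ * e₂) * - (σ * e₂))
        ≡⟨ solve 4 (λ σ e₁ e₂ N → σ :* e₁ :* (σ :* e₁) :- N :* ((:- (σ :* e₂)) :* (:- (σ :* e₂)))
                                 := σ :* σ :* (e₁ :* e₁ :- N :* (e₂ :* e₂))) refl σ e₁ e₂ N′ ⟩
      σ * σ * normK N η
        ≡⟨ cong₂ _*_ σ*σ≡1 norm-η ⟩
      1ℚ * σ
        ≡⟨ ℚP.*-identityˡ σ ⟩
      σ ∎

    η-unit : IsUnitO N η
    η-unit = ((s , trace-η) , (σz , norm-η)) , η⁻¹ ,
             ((σz ℤ.* s , trace-η⁻¹) , (σz , norm-η⁻¹)) , cong₂ _,_ η·η⁻¹₁ η·η⁻¹₂
      where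
      trace-η : e₁ + e₁ ≡ S
      trace-η = solve 1 (λ S → S :* con ½ :+ S :* con ½ := S) refl S
      trace-η⁻¹ : σ * e₁ + σ * e₁ ≡ fromℤ (σz ℤ.* s)
      trace-η⁻¹ = trans (solve 2 (λ S σ → σ :* (S :* con ½) :+ σ :* (S :* con ½) := σ :* S) refl S σ) (sym (fromℤ-* σz s))
      η·η⁻¹₁ : e₁ * (σ * e₁) + N′ * (e₂ * - (σ * e₂)) ≡ 1ℚ
      η·η⁻¹₁ = trans (solve 4 (λ σ e₁ e₂ N → e₁ :* (σ :* e₁) :+ N :* (e₂ :* (:- (σ :* e₂))) := σ :* (e₁ :* e₁ :- N :* (e₂ :* e₂))) refl σ e₁ e₂ N′)
                     (trans (cong (σ *_) norm-η) σ*σ≡1)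
      η·η⁻¹₂ : e₁ * - (σ * e₂) + e₂ * (σ * e₁) ≡ 0ℚ
      η·η⁻¹₂ = solve 3 (λ σ e₁ e₂ → e₁ :* (:- (σ :* e₂)) :+ e₂ :* (σ :* e₁) := con 0ℚ) refl σ e₁ e₂

    η²≡ε : mulK N η η ≡ (a , b)
    η²≡ε = cong₂ _,_ first second
      where
      first : e₁ * e₁ + N′ * (e₂ * e₂) ≡ a
      first = trans (cong (λ x → e₁ * e₁ + x) Nb²/S²)
        (trans (solve 2 (λ S σ → S :* con ½ :* (S :* con ½) :+ (S :* S :- con four :* σ) :* (con ½ :* con ½) := (S :* S :- con two :* σ) :* con ½) refl S σ)
               (sym a≡[S²-2σ]/2))
      second : e₁ * e₂ + e₂ * e₁ ≡ b
      second = trans (solve 3 (λ S b inv → S :* con ½ :* (b :* inv) :+ b :* inv :* (S :* con ½) := b :* (inv :* S)) refl S b inv)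
                     (trans (cong (b *_) inv*S≡1) (ℚP.*-identityʳ b))

  -- Consequences for the fundamental unit ε = a + b√N of O_N (N ≥ 2):
  -- its trace t satisfies t ≥ 3 if ‖ε‖ = 1 and t ≥ 1 if ‖ε‖ = −1, and if
  -- ‖ε‖ = 1 neither t + 2 nor t − 2 is a square (else ε would have a unit
  -- square root, contradicting 'no-unit-square-root').

  trace-bound : ∀ a t σz → 0ℚ < a + a - (1ℚ + fromℤ σz) → a + a ≡ fromℤ t → + 1 ℤ.+ σz ℤ.< t
  trace-bound a t σz excess>0 trε≡t = fromℤ-<-reflects (+ 1 ℤ.+ σz) t
    (subst₂ _<_ (sym (fromℤ-+ (+ 1) σz)) trε≡t (0<-⇒< excess>0))

  offset-above : ∀ m t → + m ℤ.< t → ∃ λ k → t ≡ + (suc m ℕ.+ k)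
  offset-above m (+ n)    (ℤ.+<+ m<n) = n ℕ.∸ suc m , cong +_ (sym (ℕP.m+[n∸m]≡n m<n))
  offset-above m -[1+ _ ] ()

  data FundamentalUnitInvariants (t n : ℤ) : Set where
    normOne      : ∀ k → n ≡ + 1 → t ≡ + (3 ℕ.+ k) → ¬ IsSquare (t ℤ.+ + 2) → ¬ IsSquare (t ℤ.- + 2) →
                   FundamentalUnitInvariants t n
    normMinusOne : ∀ k → n ≡ -[1+ 0 ] → t ≡ + suc k → FundamentalUnitInvariants t n

  fundamentalUnitInvariants : ∀ N → + 2 ℤ.≤ N → ∀ ε → IsFundamentalUnit N ε →
    ∀ t → traceK ε ≡ fromℤ t → ∀ n → normK N ε ≡ fromℤ n → FundamentalUnitInvariants t n
  fundamentalUnitInvariants N 2≤N (a , b) (unit , ε>1 , generates) t trε≡t n ‖ε‖≡n =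
    byNorm n ‖ε‖≡n (norm-unit N (a , b) n ‖ε‖≡n unit)
    where
    N>0 : 0ℚ < fromℤ N
    N>0 = fromℤ-<-preserves (+ 0) N (ℤP.<-≤-trans (ℤ.+<+ (ℕ.s≤s ℕ.z≤n)) 2≤N)

    normOneCase : a * a - fromℤ N * (b * b) ≡ 1ℚ → ∀ k → t ≡ + (3 ℕ.+ k) →
                  FundamentalUnitInvariants t (+ 1)
    normOneCase ‖ε‖≡1 k t≡3+k = normOne k refl t≡3+k
      (no-square (+ 1) refl (subst (λ t → + 0 ℤ.< t ℤ.+ + 2) (sym t≡3+k) (ℤ.+<+ (ℕ.s≤s ℕ.z≤n))))
      (no-square -[1+ 0 ] refl (subst (λ t → + 0 ℤ.< t ℤ.- + 2) (sym t≡3+k) (ℤ.+<+ (ℕ.s≤s ℕ.z≤n))))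
      where
      a>1 : 0ℚ < a - 1ℚ
      a>1 = subst (0ℚ <_) (solve 1 (λ a → con ½ :* (a :+ a :- (con 1ℚ :+ con 1ℚ)) := a :- con 1ℚ) refl a)
              (pos*pos 0<½ (trace>1+norm N a b 1ℚ ℚP.≤-refl ‖ε‖≡1 ε>1))
      no-square : ∀ σz → σz ℤ.* σz ≡ + 1 → + 0 ℤ.< t ℤ.+ + 2 ℤ.* σz → ¬ IsSquare (t ℤ.+ + 2 ℤ.* σz)
      no-square σz σ²≡1 0<t+2σ (s , t+2σ≡s²) =
        Powers.no-unit-square-root N a b a>1 (norm1⇒b>0 N a b ‖ε‖≡1 ε>1) N>0 generates η η-unit η²≡ε
        where
        s≢0 : s ≢ + 0
        s≢0 s≡0 = ℤP.<-irrefl (sym (trans t+2σ≡s² (cong (λ x → x ℤ.* x) s≡0))) 0<t+2σ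
        open SquareRoot N a b t σz s ‖ε‖≡1 trε≡t σ²≡1 s≢0 t+2σ≡s²

    byNorm : ∀ n → normK N (a , b) ≡ fromℤ n → n ≡ + 1 ⊎ n ≡ -[1+ 0 ] → FundamentalUnitInvariants t n
    byNorm .(+ 1) ‖ε‖≡1 (inj₁ refl) = normOneCase ‖ε‖≡1 (proj₁ t≥3) (proj₂ t≥3)
      where
      t≥3 = offset-above 2 t (trace-bound a t (+ 1) (trace>1+norm N a b 1ℚ ℚP.≤-refl ‖ε‖≡1 ε>1) trε≡t)
    byNorm .(-[1+ 0 ]) ‖ε‖≡-1 (inj₂ refl) = normMinusOne (proj₁ t≥1) refl (proj₂ t≥1)
      where
      -1≤1 : fromℤ -[1+ 0 ] ≤ 1ℚ
      -1≤1 = ℚP.<⇒≤ (fromℤ-<-preserves -[1+ 0 ] (+ 1) ℤ.-<+)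
      t≥1 = offset-above 0 t (trace-bound a t -[1+ 0 ] (trace>1+norm N a b (fromℤ -[1+ 0 ]) -1≤1 ‖ε‖≡-1 ε>1) trε≡t)

open import Defs
open Polynomial
open Biquadratic
open SquareClass
open IntegerSquares
open QuadraticField
open import Data.Nat as ℕ using (ℕ; zero; suc)
import Data.Nat.Properties as ℕP
open import Data.Integer as ℤ using (ℤ; +_; -[1+_]; _+_; _-_; _*_; -_; _≤_)
import Data.Integer.Properties as ℤP
open import Data.Integer.Tactic.RingSolver using (solve; solve-∀)
open import Data.List using (_∷_; [])
open import Data.Product using (∃; _×_; _,_; proj₁; proj₂)
open import Data.Sum using (_⊎_; inj₁; inj₂)
open import Data.Empty using (⊥-elim)
open import Relation.Nullary using (¬_)
open import Function.Bundles using (_⇔_; mk⇔)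
open import Relation.Binary.PropositionalEquality
open ≡-Reasoning

quartic-monic : ∀ κ t n → MonicBiquadratic (quartic κ t n)
quartic-monic κ t n = above , refl , refl , refl
  where
  above : DegreeAtMost (quartic κ t n) 4
  above (suc (suc (suc (suc (suc i))))) _ = refl
  above 0 ()
  above 1 (ℕ.s≤s ())
  above 2 (ℕ.s≤s (ℕ.s≤s ()))
  above 3 (ℕ.s≤s (ℕ.s≤s (ℕ.s≤s ())))
  above 4 (ℕ.s≤s (ℕ.s≤s (ℕ.s≤s (ℕ.s≤s ()))))

quartic-splits : ∀ κ t n → ReducibleZ (quartic κ t n) → Splits (- (κ * t)) (n * (κ * κ))
quartic-splits κ t n = reducible⇒splits (quartic κ t n) (quartic-monic κ t n)

discriminant-square : ∀ κ t n s → κ ≢ + 0 →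
  - (κ * t) * - (κ * t) - + 4 * (n * (κ * κ)) ≡ s * s → IsSquare (t * t - + 4 * n)
discriminant-square κ t n s κ≢0 disc≡s² = square-cofactorℤ κ (t * t - + 4 * n) s κ≢0 (begin
  κ * κ * (t * t - + 4 * n)                      ≡⟨ solve (κ ∷ t ∷ n ∷ []) ⟩
  - (κ * t) * - (κ * t) - + 4 * (n * (κ * κ))    ≡⟨ disc≡s² ⟩
  s * s                                          ∎)

-- The discriminants t² − 4n met for a fundamental unit are not squares:
-- t² − 4 for t ≥ 3 lies strictly between (t − 1)² and t², and t² + 4
-- for t ≥ 1 strictly between t² and (t + 1)² (t = 1 aside: 5 is no square).
t²-4-nonSquare : ∀ k → ¬ IsSquare (+ (3 ℕ.+ k) * + (3 ℕ.+ k) - + 4 * + 1)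
t²-4-nonSquare k (s , t²-4≡s²) =
  between-squares (2 ℕ.+ k) (suc k ℕ.* (k ℕ.+ 5)) below above ℤ.∣ s ∣ (ℤP.+-injective (begin
    + (suc k ℕ.* (k ℕ.+ 5))                ≡⟨ ℤP.pos-* (suc k) (k ℕ.+ 5) ⟩
    + suc k * + (k ℕ.+ 5)                  ≡⟨ factor (+ k) ⟩
    + (3 ℕ.+ k) * + (3 ℕ.+ k) - + 4 * + 1  ≡⟨ t²-4≡s² ⟩
    s * s                                  ≡⟨ square≡+abs² s ⟩
    + (ℤ.∣ s ∣ ℕ.* ℤ.∣ s ∣)                ∎))
  where
  factor : ∀ K → (+ 1 + K) * (K + + 5) ≡ (+ 3 + K) * (+ 3 + K) - + 4 * + 1
  factor = solve-∀
  open import Data.Nat.Tactic.RingSolver renaming (solve-∀ to solveℕ-∀)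
  gap₁ : ∀ k → (2 ℕ.+ k) ℕ.* (2 ℕ.+ k) ℕ.+ suc (k ℕ.+ k) ≡ suc k ℕ.* (k ℕ.+ 5)
  gap₁ = solveℕ-∀
  gap₂ : ∀ k → suc k ℕ.* (k ℕ.+ 5) ℕ.+ 4 ≡ (3 ℕ.+ k) ℕ.* (3 ℕ.+ k)
  gap₂ = solveℕ-∀
  below : (2 ℕ.+ k) ℕ.* (2 ℕ.+ k) ℕ.< suc k ℕ.* (k ℕ.+ 5)
  below = subst ((2 ℕ.+ k) ℕ.* (2 ℕ.+ k) ℕ.<_) (gap₁ k) (ℕP.m<m+n _ (ℕ.s≤s ℕ.z≤n))
  above : suc k ℕ.* (k ℕ.+ 5) ℕ.< (3 ℕ.+ k) ℕ.* (3 ℕ.+ k)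
  above = subst (suc k ℕ.* (k ℕ.+ 5) ℕ.<_) (gap₂ k) (ℕP.m<m+n _ (ℕ.s≤s ℕ.z≤n))

t²+4-nonSquare : ∀ k → ¬ IsSquare (+ suc k * + suc k - + 4 * -[1+ 0 ])
t²+4-nonSquare k (s , t²+4≡s²) = between k (ℤP.+-injective (begin
    + (suc k ℕ.* suc k ℕ.+ 4)               ≡⟨ cong (_+ + 4) (ℤP.pos-* (suc k) (suc k)) ⟩
    + suc k * + suc k + + 4                 ≡⟨ shift (+ k) ⟩
    + suc k * + suc k - + 4 * -[1+ 0 ]      ≡⟨ t²+4≡s² ⟩
    s * s                                   ≡⟨ square≡+abs² s ⟩
    + (ℤ.∣ s ∣ ℕ.* ℤ.∣ s ∣)                 ∎))
  where
  shift : ∀ K → (+ 1 + K) * (+ 1 + K) + + 4 ≡ (+ 1 + K) * (+ 1 + K) - + 4 * -[1+ 0 ]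
  shift = solve-∀
  open import Data.Nat.Tactic.RingSolver renaming (solve-∀ to solveℕ-∀)
  gap : ∀ j → (2 ℕ.+ j) ℕ.* (2 ℕ.+ j) ℕ.+ 4 ℕ.+ suc (j ℕ.+ j) ≡ (3 ℕ.+ j) ℕ.* (3 ℕ.+ j)
  gap = solveℕ-∀
  between : ∀ k → suc k ℕ.* suc k ℕ.+ 4 ≢ ℤ.∣ s ∣ ℕ.* ℤ.∣ s ∣
  between zero    = between-squares 2 5 (ℕP.n<1+n 4) (ℕP.m<m+n 5 {4} (ℕ.s≤s ℕ.z≤n)) ℤ.∣ s ∣
  between (suc j) = between-squares (2 ℕ.+ j) _ (ℕP.m<m+n _ (ℕ.s≤s ℕ.z≤n))
    (subst ((2 ℕ.+ j) ℕ.* (2 ℕ.+ j) ℕ.+ 4 ℕ.<_) (gap j) (ℕP.m<m+n _ (ℕ.s≤s ℕ.z≤n))) ℤ.∣ s ∣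

-- Norm −1: for t ≥ 1 and κ ≠ 0 the quartic x⁴ − κt x² − κ² is
-- irreducible, since t² + 4 is no square and −κ² = d² is impossible.
normMinusOne-irreducible : ∀ k κ → κ ≢ + 0 → ¬ ReducibleZ (quartic κ (+ suc k) -[1+ 0 ])
normMinusOne-irreducible k κ κ≢0 reducible with quartic-splits κ (+ suc k) -[1+ 0 ] reducible
... | inj₁ (s , disc≡s²) = t²+4-nonSquare k (discriminant-square κ (+ suc k) -[1+ 0 ] s κ≢0 disc≡s²)
... | inj₂ (d , _ , -κ²≡d² , _) = negative-square κ κ≢0 (d , -κ²≡d²)
  where
  negative-square : ∀ κ → κ ≢ + 0 → ¬ IsSquare (-[1+ 0 ] * (κ * κ))
  negative-square (+ zero)  κ≢0 _      = κ≢0 refl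
  negative-square (+ suc j) _   square = negative-nonSquare _ square
  negative-square -[1+ j ]  _   square = negative-nonSquare _ square

-- The discriminant κ²(t² − 4) is then no square, so κ² = d²
-- with d = ±κ and 2d + κt = κ(t ± 2) = p²; conversely the quartic is
-- then (x² + d)² − (px)².
normOne-reducible⇒square : ∀ t κ → ¬ IsSquare (t * t - + 4 * + 1) → κ ≢ + 0 →
  ReducibleZ (quartic κ t (+ 1)) → IsSquare (κ * (t + + 2)) ⊎ IsSquare (κ * (t - + 2))
normOne-reducible⇒square t κ t²-4-nonSquare κ≢0 reducible with quartic-splits κ t (+ 1) reducible
... | inj₁ (s , disc≡s²) = ⊥-elim (t²-4-nonSquare (discriminant-square κ t (+ 1) s κ≢0 disc≡s²))
... | inj₂ (d , p , κ²≡d² , 2d+κt≡p²) with equal-squares κ d (trans (sym (ℤP.*-identityˡ (κ * κ))) κ²≡d²)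
...   | inj₁ refl = inj₁ (p , (begin
  κ * (t + + 2)           ≡⟨ solve (κ ∷ t ∷ []) ⟩
  + 2 * κ - - (κ * t)     ≡⟨ 2d+κt≡p² ⟩
  p * p                   ∎))
...   | inj₂ refl = inj₂ (p , (begin
  κ * (t - + 2)           ≡⟨ solve (κ ∷ t ∷ []) ⟩
  + 2 * - κ - - (κ * t)   ≡⟨ 2d+κt≡p² ⟩
  p * p                   ∎))

square⇒normOne-reducible₊ : ∀ t κ → IsSquare (κ * (t + + 2)) → ReducibleZ (quartic κ t (+ 1))
square⇒normOne-reducible₊ t κ (p , κ[t+2]≡p²) =
  differenceOfSquares⇒reducible (quartic κ t (+ 1)) κ p (quartic-monic κ t (+ 1)) (ℤP.*-identityˡ (κ * κ)) (begin
    - (κ * t)                 ≡⟨ solve (κ ∷ t ∷ []) ⟩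
    + 2 * κ - κ * (t + + 2)   ≡⟨ cong (λ x → + 2 * κ - x) κ[t+2]≡p² ⟩
    + 2 * κ - p * p           ∎)

square⇒normOne-reducible₋ : ∀ t κ → IsSquare (κ * (t - + 2)) → ReducibleZ (quartic κ t (+ 1))
square⇒normOne-reducible₋ t κ (p , κ[t-2]≡p²) =
  differenceOfSquares⇒reducible (quartic κ t (+ 1)) (- κ) p (quartic-monic κ t (+ 1)) (begin
    + 1 * (κ * κ)             ≡⟨ solve (κ ∷ []) ⟩
    - κ * - κ                 ∎) (begin
    - (κ * t)                 ≡⟨ solve (κ ∷ t ∷ []) ⟩
    + 2 * - κ - κ * (t - + 2) ≡⟨ cong (λ x → + 2 * - κ - x) κ[t-2]≡p² ⟩
    + 2 * - κ - p * p         ∎)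

2≤κ⇒κ≢0 : ∀ {κ} → + 2 ≤ κ → κ ≢ + 0
2≤κ⇒κ≢0 (ℤ.+≤+ ()) refl

normMinusOne-noGoodPair : ∀ k κ₁ κ₂ → ¬ GoodPair (+ suc k) -[1+ 0 ] κ₁ κ₂
normMinusOne-noGoodPair k κ₁ κ₂ (_ , _ , 2≤κ₁ , _ , _ , reducible₁ , _) =
  normMinusOne-irreducible k κ₁ (2≤κ⇒κ≢0 2≤κ₁) reducible₁

-- For a fundamental unit of norm 1 and trace t = 3 + k, with t ± 2 not
-- squares: the square classes A of t + 2 and B of t − 2 form a good
-- pair (A, B ≥ 2 as t ± 2 are no squares, A ≠ B as t² − 4 is none), and
-- every good pair is {A, B}.
module NormOne (k : ℕ) (¬square₊ : ¬ IsSquare (+ (3 ℕ.+ k) + + 2)) (¬square₋ : ¬ IsSquare (+ (3 ℕ.+ k) - + 2))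
               (A B : ℤ) (1≤A : + 1 ≤ A) (classA : IsSquareClass (+ (3 ℕ.+ k) + + 2) A)
                         (1≤B : + 1 ≤ B) (classB : IsSquareClass (+ (3 ℕ.+ k) - + 2) B) where

  private
    t = + (3 ℕ.+ k)

    nonSquare⇒≥2 : ∀ {X} C → + 1 ≤ C → IsSquareClass X C → ¬ IsSquare X → + 2 ≤ C
    nonSquare⇒≥2 {X} (+ 1)           _          (squareClassWith _ (p , 1X≡p²) _) ¬square =
      ⊥-elim (¬square (p , trans (sym (ℤP.*-identityˡ X)) 1X≡p²))
    nonSquare⇒≥2     (+ suc (suc j)) _          _ _ = ℤ.+≤+ (ℕ.s≤s (ℕ.s≤s ℕ.z≤n))
    nonSquare⇒≥2     (+ 0)           (ℤ.+≤+ ()) _ _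
    nonSquare⇒≥2     -[1+ j ]        ()         _ _

  open IsSquareClass classA renaming (squareFree to sqfA; square to squareA; unique to uniqueA)
  open IsSquareClass classB renaming (squareFree to sqfB; square to squareB; unique to uniqueB)

  2≤A : + 2 ≤ A
  2≤A = nonSquare⇒≥2 A 1≤A classA ¬square₊

  2≤B : + 2 ≤ B
  2≤B = nonSquare⇒≥2 B 1≤B classB ¬square₋

  A≢B : A ≢ B
  A≢B A≡B = t²-4-nonSquare k (square-cofactorℤ A (t * t - + 4 * + 1) (p * q) (2≤κ⇒κ≢0 2≤A) (begin
    A * A * (t * t - + 4 * + 1)     ≡⟨ factor A t ⟩
    A * (t + + 2) * (A * (t - + 2)) ≡⟨ cong₂ _*_ A[t+2]≡p² (trans (cong (λ C → C * (t - + 2)) A≡B) B[t-2]≡q²) ⟩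
    p * p * (q * q)                 ≡⟨ regroup p q ⟩
    p * q * (p * q)                 ∎))
    where
    p = proj₁ squareA
    A[t+2]≡p² = proj₂ squareA
    q = proj₁ squareB
    B[t-2]≡q² = proj₂ squareB
    factor : ∀ A t → A * A * (t * t - + 4 * + 1) ≡ A * (t + + 2) * (A * (t - + 2))
    factor = solve-∀
    regroup : ∀ p q → p * p * (q * q) ≡ p * q * (p * q)
    regroup = solve-∀

  goodPair : GoodPair t (+ 1) A B
  goodPair = sqfA , sqfB , 2≤A , 2≤B , A≢B ,
             square⇒normOne-reducible₊ t A squareA , square⇒normOne-reducible₋ t B squareB

  private
    classesAB : ∀ κ₁ κ₂ → κ₁ ≡ A → κ₂ ≡ B → SquareClasses t κ₁ κ₂
    classesAB .A .B refl refl = squareA , squareB , uniqueA , uniqueB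

    which : ∀ κ → + 2 ≤ κ → ReducibleZ (quartic κ t (+ 1)) → IsSquare (κ * (t + + 2)) ⊎ IsSquare (κ * (t - + 2))
    which κ 2≤κ = normOne-reducible⇒square t κ (t²-4-nonSquare k) (2≤κ⇒κ≢0 2≤κ)

    sort : ∀ κ₁ κ₂ → SquareFree κ₁ → SquareFree κ₂ → κ₁ ≢ κ₂ →
           IsSquare (κ₁ * (t + + 2)) ⊎ IsSquare (κ₁ * (t - + 2)) →
           IsSquare (κ₂ * (t + + 2)) ⊎ IsSquare (κ₂ * (t - + 2)) →
           SquareClasses t κ₁ κ₂ ⊎ SquareClasses t κ₂ κ₁
    sort κ₁ κ₂ sqf₁ sqf₂ κ₁≢κ₂ (inj₁ sq₁) (inj₁ sq₂) = ⊥-elim (κ₁≢κ₂ (trans (uniqueA κ₁ sqf₁ sq₁) (sym (uniqueA κ₂ sqf₂ sq₂))))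
    sort κ₁ κ₂ sqf₁ sqf₂ κ₁≢κ₂ (inj₂ sq₁) (inj₂ sq₂) = ⊥-elim (κ₁≢κ₂ (trans (uniqueB κ₁ sqf₁ sq₁) (sym (uniqueB κ₂ sqf₂ sq₂))))
    sort κ₁ κ₂ sqf₁ sqf₂ _     (inj₁ sq₁) (inj₂ sq₂) = inj₁ (classesAB κ₁ κ₂ (uniqueA κ₁ sqf₁ sq₁) (uniqueB κ₂ sqf₂ sq₂))
    sort κ₁ κ₂ sqf₁ sqf₂ _     (inj₂ sq₁) (inj₁ sq₂) = inj₂ (classesAB κ₂ κ₁ (uniqueA κ₂ sqf₂ sq₂) (uniqueB κ₁ sqf₁ sq₁))

  goodPair⇒classes : ∀ κ₁ κ₂ → GoodPair t (+ 1) κ₁ κ₂ → SquareClasses t κ₁ κ₂ ⊎ SquareClasses t κ₂ κ₁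
  goodPair⇒classes κ₁ κ₂ (sqf₁ , sqf₂ , 2≤κ₁ , 2≤κ₂ , κ₁≢κ₂ , reducible₁ , reducible₂) =
    sort κ₁ κ₂ sqf₁ sqf₂ κ₁≢κ₂ (which κ₁ 2≤κ₁ reducible₁) (which κ₂ 2≤κ₂ reducible₂)

Conclusion : ℤ → ℤ → Set
Conclusion t n =
  ((∃ λ κ₁ → ∃ λ κ₂ → GoodPair t n κ₁ κ₂) ⇔ (n ≡ + 1)) ×
  (n ≡ + 1 → ∀ κ₁ κ₂ → GoodPair t n κ₁ κ₂ → SquareClasses t κ₁ κ₂ ⊎ SquareClasses t κ₂ κ₁)

normMinusOne-conclusion : ∀ k → Conclusion (+ suc k) -[1+ 0 ]
normMinusOne-conclusion k =
  mk⇔ (λ (κ₁ , κ₂ , good) → ⊥-elim (normMinusOne-noGoodPair k κ₁ κ₂ good)) (λ ()) , λ ()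

normOne-conclusion : ∀ k → ¬ IsSquare (+ (3 ℕ.+ k) + + 2) → ¬ IsSquare (+ (3 ℕ.+ k) - + 2) →
  Conclusion (+ (3 ℕ.+ k)) (+ 1)
normOne-conclusion k ¬square₊ ¬square₋ = fromClasses (squareClass (suc (suc (k ℕ.+ 2)))) (squareClass k)
  where
  fromClasses : (∃ λ A → + 1 ≤ A × IsSquareClass (+ (3 ℕ.+ k) + + 2) A) →
                (∃ λ B → + 1 ≤ B × IsSquareClass (+ (3 ℕ.+ k) - + 2) B) → Conclusion (+ (3 ℕ.+ k)) (+ 1)
  fromClasses (A , 1≤A , classA) (B , 1≤B , classB) =
    mk⇔ (λ _ → refl) (λ _ → A , B , goodPair) , λ _ → goodPair⇒classes
    where open NormOne k ¬square₊ ¬square₋ A B 1≤A classA 1≤B classB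

invariants⇒conclusion : ∀ t n → FundamentalUnitInvariants t n → Conclusion t n
invariants⇒conclusion .(+ suc k) .(-[1+ 0 ]) (normMinusOne k refl refl) = normMinusOne-conclusion k
invariants⇒conclusion .(+ (3 ℕ.+ k)) .(+ 1) (normOne k refl refl ¬square₊ ¬square₋) =
  normOne-conclusion k ¬square₊ ¬square₋

lemma3p2 : (N : ℤ) → + 2 ≤ N → SquareFree N →
    (ε : K) → IsFundamentalUnit N ε →
    (t : ℤ) → traceK ε ≡ fromℤ t →
    (n : ℤ) → normK N ε ≡ fromℤ n →
    ((∃ λ κ₁ → ∃ λ κ₂ → GoodPair t n κ₁ κ₂) ⇔ (n ≡ + 1)) ×
    (n ≡ + 1 → ∀ κ₁ κ₂ → GoodPair t n κ₁ κ₂ →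
       SquareClasses t κ₁ κ₂ ⊎ SquareClasses t κ₂ κ₁)
lemma3p2 N 2≤N _ ε fundamental t trε≡t n ‖ε‖≡n =
  invariants⇒conclusion t n (fundamentalUnitInvariants N 2≤N ε fundamental t trε≡t n ‖ε‖≡n)
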